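{- Let $w,x,y,z$ be formal variables. For $n\ge 1$ let $G_n(w,x,y,z)$ be the formal power series $$G_n(w,x,y,z)=\sum_{S} w^{L(S)}x^{F(S)}y^{B(S)}z^{C(S)},$$ where the sum runs over all valid first-tree explorations $S$ on $\{1,\dots,n\}$ (defined in the context). Then $$G_1(w,x,y,z)=\frac{1}{1-w},$$ and for every $n\ge 2$, $$G_n(w,x,y,z)=\frac{1}{1-w-(n-1)x}\sum_{m=1}^{n-1}G_m(w,x,y,z)\,G_{n-m}\bigl(w+y+(m-1)z,\,x,\,y,\,z\bigr).$$
   Context: Depth-first search (DFS) exploration of a tree. A finite sequence $S=(a_1,\dots,a_N)$ of arcs $a_k=(u_k,v_k)$ with $u_k,v_k\in\{1,\dots,n\}$ is processed as follows. Maintain a set of discovered vertices and an "active path" (a stack) of discovered vertices; initially only vertex $1$ is discovered and the active path is $(1)$. The arc $a_k=(u_k,v_k)$ is admissible only if $u_k$ lies on the current active path; then all vertices above $u_k$ are removed from the active path (they are finished), so $u_k$ becomes the current vertex, and the arc is classified as: a loop if $v_k=u_k$; a tree arc if $v_k$ is not yet discovered (then $v_k$ becomes discovered, becomes a child of $u_k$ in the tree being built, and is pushed onto the active path); a back arc if $v_k\ne u_k$ is on the active path (a proper ancestor of $u_k$); a forward arc if $v_k$ is an already discovered proper descendant of $u_k$ in the tree; a cross arc otherwise. A valid first-tree exploration on $\{1,\dots,n\}$ is a finite sequence of admissible arcs (all arcs admissible in turn) in which every vertex of $\{1,\dots,n\}$ is discovered, and the vertices are discovered in the order $1,2,\dots,n$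 (vertex $1$ is the root; the $k$-th discovered vertex is $k$). Distinct sequences are counted separately. $L(S),F(S),B(S),C(S)$ denote the numbers of loops, forward arcs, back arcs and cross arcs in $S$ (the number of tree arcs is then $n-1$). The rational functions on the right side are interpreted as formal power series. -}

module Defs where

open import Data.Nat using (ℕ; zero; suc; _+_; _*_; _∸_; _≡ᵇ_)
open import Data.Bool using (Bool; true; false; _∧_; _∨_; not; if_then_else_)
open import Data.List using (List; []; _∷_; length; map; filterᵇ; cartesianProduct; concatMap; applyUpTo; _++_)
open import Data.Product using (_×_; _,_)
open import Data.Maybe using (Maybe; just; nothing)
open import Relation.Binary.PropositionalEquality using (_≡_)

Arc : Set
Arc = ℕ × ℕ

_∈ᵇ_ : ℕ → List ℕ → Bool
v ∈ᵇ []       = false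
v ∈ᵇ (x ∷ xs) = (v ≡ᵇ x) ∨ (v ∈ᵇ xs)

data Kind : Set where
  loop tree back forward cross : Kind

-- state of the exploration:
--   discovered vertices (in order of discovery),
--   active path (top of the stack = head of the list),
--   tree built so far, as a list of (child , parent) pairs
record State : Set where
  constructor st
  field
    discovered : List ℕ
    active     : List ℕ
    parentMap  : List (ℕ × ℕ)
open State public

initState : State
initState = st (1 ∷ []) (1 ∷ []) []

parentOf : List (ℕ × ℕ) → ℕ → Maybe ℕ
parentOf []              v = nothing
parentOf ((c , p) ∷ ps)  v = if v ≡ᵇ c then just p else parentOf ps v

-- proper ancestors of v in the tree (fuel bounds the depth; the tree has
-- at most 'fuel' vertices, so fuel = number of discovered vertices suffices)
ancestors : ℕ → List (ℕ × ℕ) → ℕ → List ℕ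
ancestors zero    t v = []
ancestors (suc f) t v with parentOf t v
... | nothing = []
... | just p  = p ∷ ancestors f t p

popTo : ℕ → List ℕ → List ℕ
popTo u []       = []
popTo u (x ∷ xs) = if u ≡ᵇ x then x ∷ xs else popTo u xs

-- Returns nothing if the arc is not admissible, or if it is a
-- tree arc that does not discover the next vertex in the order 1,2,...,n
-- (such a sequence is not a valid first-tree exploration).
step : State → Arc → Maybe (State × Kind)
step (st d act t) (u , v) =
  if not (u ∈ᵇ act) then nothing else
  (if v ≡ᵇ u then just (st d act' t , loop)
   else if not (v ∈ᵇ d) then
     (if v ≡ᵇ suc (length d)
      then just (st (d ++ (v ∷ [])) (v ∷ act') ((v , u) ∷ t) , tree)
      else nothing)
   else if v ∈ᵇ act' then just (st d act' t , back)
   else if u ∈ᵇ ancestors (length d) t v then just (st d act' t , forward)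
   else just (st d act' t , cross))
  where
    act' = popTo u act

record Stats : Set where
  constructor stats
  field
    nL nF nB nC : ℕ

bump : Kind → Stats → Stats
bump loop    (stats l f b c) = stats (suc l) f b c
bump tree    s               = s
bump back    (stats l f b c) = stats l f (suc b) c
bump forward (stats l f b c) = stats l (suc f) b c
bump cross   (stats l f b c) = stats l f b (suc c)

run : State → Stats → List Arc → Maybe (State × Stats)
run s acc []       = just (s , acc)
run s acc (a ∷ as) with step s a
... | nothing        = nothing
... | just (s' , k)  = run s' (bump k acc) as

-- S is a valid first-tree exploration on {1..n} with L=a, F=b, B=c, C=d
-- (all arcs are taken from {1..n}² by the enumeration below)
validWith : ℕ → ℕ → ℕ → ℕ → ℕ → List Arc → Bool
validWith n a b c d S with run initState (stats 0 0 0 0) S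
... | nothing = false
... | just (s , stats l f bb cc) =
  (length (discovered s) ≡ᵇ n) ∧ (l ≡ᵇ a) ∧ (f ≡ᵇ b) ∧ (bb ≡ᵇ c) ∧ (cc ≡ᵇ d)

oneTo : ℕ → List ℕ
oneTo n = applyUpTo suc n

arcs : ℕ → List Arc
arcs n = cartesianProduct (oneTo n) (oneTo n)

seqs : ℕ → ℕ → List (List Arc)
seqs n zero    = [] ∷ []
seqs n (suc N) = concatMap (λ a → map (a ∷_) (seqs n N)) (arcs n)

-- coefficient of w^a x^b y^c z^d
Series : Set
Series = ℕ → ℕ → ℕ → ℕ → ℕ

_≈ₛ_ : Series → Series → Set
f ≈ₛ g = ∀ a b c d → f a b c d ≡ g a b c d


sumTo : ℕ → (ℕ → ℕ) → ℕ
sumTo zero    f = f 0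
sumTo (suc k) f = sumTo k f + f (suc k)

oneS wS xS yS zS : Series
oneS 0 0 0 0 = 1
oneS _ _ _ _ = 0
wS 1 0 0 0 = 1
wS _ _ _ _ = 0
xS 0 1 0 0 = 1
xS _ _ _ _ = 0
yS 0 0 1 0 = 1
yS _ _ _ _ = 0
zS 0 0 0 1 = 1
zS _ _ _ _ = 0

zeroS : Series
zeroS _ _ _ _ = 0

_⊕_ : Series → Series → Series
(f ⊕ g) a b c d = f a b c d + g a b c d
infixl 6 _⊕_

_·_ : ℕ → Series → Series
(k · f) a b c d = k * f a b c d
infixl 7 _·_

_⊗_ : Series → Series → Series
(f ⊗ g) a b c d =
  sumTo a λ i → sumTo b λ j → sumTo c λ k → sumTo d λ l →
    f i j k l * g (a ∸ i) (b ∸ j) (c ∸ k) (d ∸ l)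
infixl 7 _⊗_

_^ₛ_ : Series → ℕ → Series
f ^ₛ zero  = oneS
f ^ₛ suc k = f ⊗ (f ^ₛ k)

-- 1/(1-u) = Σ_k u^k, for a series u without constant term
-- (then u^k only has monomials of total degree ≥ k, so the sum is finite
--  coefficientwise)
inv1- : Series → Series
inv1- u a b c d = sumTo (a + b + c + d) λ k → (u ^ₛ k) a b c d

-- g(s, x, y, z) for a series s without constant term:
--   Σ_{a',b',c',d'} g(a',b',c',d') s^{a'} x^{b'} y^{c'} z^{d'}
-- (only a' ≤ total degree contributes)
substW : Series → Series → Series
substW s g a b c d =
  sumTo (a + b + c + d) λ a' → sumTo b λ b' → sumTo c λ c' → sumTo d λ d' →
    g a' b' c' d' * (s ^ₛ a') a (b ∸ b') (c ∸ c') (d ∸ d')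

sumS1 : ℕ → (ℕ → Series) → Series
sumS1 zero    F = zeroS
sumS1 (suc k) F = sumS1 k F ⊕ F (suc k)

-- coefficient of w^a x^b y^c z^d in G_n = number of valid first-tree
-- explorations S on {1..n} with L(S)=a, F(S)=b, B(S)=c, C(S)=d.
-- Such an S has exactly (n-1) tree arcs, hence length (n-1)+a+b+c+d,
-- so it suffices to enumerate sequences of that length.
G : ℕ → Series
G n a b c d = length (filterᵇ (validWith n a b c d) (seqs n ((n ∸ 1) + a + b + c + d)))

module Submission where

-- Let Φ N k p be the generating series of the ways to finish an exploration on N vertices from the
-- state in which 1, …, k are discovered and p is the active path. Conditioning on the next arc (pop
-- to a suffix q of p, then a non-tree arc from the top of q, or the tree arc discovering k + 1) gives
-- a recursion whose solution is unique, because every arc raises either the degree or k.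
-- For n ≥ 2 a second solution comes from splitting at the discovery of the root's last child m + 1:
-- an exploration of 1, …, m, then one of the subtree of m + 1 on n ∸ m vertices with w ↦ w + y + (m ∸ 1) z,
-- then the loops and forward arcs at the root, counted by 1 / (1 − w − (n ∸ 1) x).
-- Uniqueness identifies the two solutions; for n = 1 the solution is 1 / (1 − w).

open import Level using (0ℓ)
open import Algebra.Bundles using (CommutativeSemiring)
open import Relation.Binary.Structures using (IsEquivalence)
open import Algebra.Structures.Biased using (isCommutativeSemiringˡ; isCommutativeMonoidˡ)
import Algebra.Properties.CommutativeSemigroup as CommSemigroupProperties
open import Data.Nat using (ℕ; zero; suc; _∸_; z≤n; s≤s; _≤_; _<_; _≟_)
import Data.Nat.Properties as ℕₚ
open import Relation.Binary.PropositionalEquality as ≡ using (_≡_; _≢_)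
open import Data.Sum using (inj₁; inj₂)
open import Data.Bool using (Bool; true; false; T; if_then_else_; _∨_; _∧_; not)
open import Data.List using (List; []; _∷_; [_]; length; map; _++_; filterᵇ; concatMap; cartesianProduct)
open import Data.Product using (_×_; _,_; proj₁; proj₂; ∃-syntax; map₂)
open import Data.Empty using (⊥; ⊥-elim)
open import Data.Unit using (⊤; tt)
open import Data.Maybe using (Maybe; just; nothing)
open import Relation.Nullary using (yes; no)
open import Function using (_∘_)
import Data.List.Properties as Listₚ
import Data.Bool.Properties as Boolₚ
open import Data.Nat.Tactic.RingSolver using (solve-∀)

-- Formal power series over a commutative semiring

module Summation (R : CommutativeSemiring 0ℓ 0ℓ) where
  open CommutativeSemiring R
  open CommSemigroupProperties +-commutativeSemigroup using (interchange)
  open import Relation.Binary.Reasoning.Setoid setoid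

  ∑ : ℕ → (ℕ → Carrier) → Carrier
  ∑ zero    h = h 0
  ∑ (suc n) h = ∑ n h + h (suc n)

  ∑-cong : ∀ n {h h′} → (∀ i → i ≤ n → h i ≈ h′ i) → ∑ n h ≈ ∑ n h′
  ∑-cong zero    e = e 0 z≤n
  ∑-cong (suc n) e = +-cong (∑-cong n (λ i i≤n → e i (ℕₚ.m≤n⇒m≤1+n i≤n))) (e (suc n) ℕₚ.≤-refl)

  ∑-cong′ : ∀ n {h h′} → (∀ i → h i ≈ h′ i) → ∑ n h ≈ ∑ n h′
  ∑-cong′ n e = ∑-cong n (λ i _ → e i)

  ∑-distrib-+ : ∀ n h h′ → ∑ n (λ i → h i + h′ i) ≈ ∑ n h + ∑ n h′
  ∑-distrib-+ zero    h h′ = refl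
  ∑-distrib-+ (suc n) h h′ = trans (+-congʳ (∑-distrib-+ n h h′)) (interchange _ _ _ _)

  *-distribˡ-∑ : ∀ n x h → x * ∑ n h ≈ ∑ n (λ i → x * h i)
  *-distribˡ-∑ zero    x h = refl
  *-distribˡ-∑ (suc n) x h = trans (distribˡ x _ _) (+-congʳ (*-distribˡ-∑ n x h))

  *-distribʳ-∑ : ∀ n x h → ∑ n h * x ≈ ∑ n (λ i → h i * x)
  *-distribʳ-∑ n x h = trans (*-comm _ x) (trans (*-distribˡ-∑ n x h) (∑-cong′ n (λ i → *-comm x (h i))))

  ∑-zero : ∀ n h → (∀ i → i ≤ n → h i ≈ 0#) → ∑ n h ≈ 0#
  ∑-zero n h e = trans (∑-cong n e) (zeros n)
    where
    zeros : ∀ n → ∑ n (λ _ → 0#) ≈ 0#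
    zeros zero    = refl
    zeros (suc n) = trans (+-identityʳ _) (zeros n)

  ∑-split-head : ∀ n h → ∑ (suc n) h ≈ h 0 + ∑ n (λ i → h (suc i))
  ∑-split-head zero    h = refl
  ∑-split-head (suc n) h = trans (+-congʳ (∑-split-head n h)) (+-assoc _ _ _)

  ∑-reverse : ∀ n h → ∑ n h ≈ ∑ n (λ i → h (n ∸ i))
  ∑-reverse zero    h = refl
  ∑-reverse (suc n) h =
    trans (+-congʳ (∑-reverse n h)) (trans (+-comm _ _) (sym (∑-split-head n (λ i → h (suc n ∸ i)))))

  ∑-triangle : ∀ n (F : ℕ → ℕ → Carrier) →
    ∑ n (λ i → ∑ (n ∸ i) (F i)) ≈ ∑ n (λ t → ∑ t (λ i → F i (t ∸ i)))
  ∑-triangle zero    F = refl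
  ∑-triangle (suc n) F = begin
    ∑ (suc n) (λ i → ∑ (suc n ∸ i) (F i))
      ≈⟨ +-cong (∑-cong n (λ i i≤n → reflexive (≡.cong (λ m → ∑ m (F i)) (ℕₚ.+-∸-assoc 1 i≤n))))
                (reflexive (≡.cong (λ m → ∑ m (F (suc n))) (ℕₚ.n∸n≡0 n))) ⟩
    ∑ n (λ i → ∑ (n ∸ i) (F i) + F i (suc (n ∸ i))) + F (suc n) 0
      ≈⟨ trans (+-congʳ (∑-distrib-+ n _ _)) (+-assoc _ _ _) ⟩
    ∑ n (λ i → ∑ (n ∸ i) (F i)) + (∑ n (λ i → F i (suc (n ∸ i))) + F (suc n) 0)
      ≈⟨ +-cong (∑-triangle n F)
                (+-cong (∑-cong n (λ i i≤n → reflexive (≡.cong (F i) (≡.sym (ℕₚ.+-∸-assoc 1 i≤n)))))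
                        (reflexive (≡.cong (F (suc n)) (≡.sym (ℕₚ.n∸n≡0 n))))) ⟩
    ∑ (suc n) (λ t → ∑ t (λ i → F i (t ∸ i))) ∎

module Convolution (R : CommutativeSemiring 0ℓ 0ℓ) where
  open CommutativeSemiring R
  open Summation R
  open import Relation.Binary.Reasoning.Setoid setoid

  _⋆_ : (ℕ → Carrier) → (ℕ → Carrier) → ℕ → Carrier
  (f ⋆ g) n = ∑ n (λ i → f i * g (n ∸ i))

  one : ℕ → Carrier
  one zero    = 1#
  one (suc _) = 0#

  ⋆-comm : ∀ f g n → (f ⋆ g) n ≈ (g ⋆ f) n
  ⋆-comm f g n = trans (∑-reverse n _) (∑-cong n (λ i i≤n →
    trans (*-congˡ (reflexive (≡.cong g (ℕₚ.m∸[m∸n]≡n i≤n)))) (*-comm _ _)))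

  one-⋆ : ∀ f n → (one ⋆ f) n ≈ f n
  one-⋆ f zero    = *-identityˡ (f 0)
  one-⋆ f (suc n) = trans (∑-split-head n _)
    (trans (+-cong (*-identityˡ _) (∑-zero n _ (λ i _ → zeroˡ _))) (+-identityʳ _))

  ⋆-assoc : ∀ f g h n → ((f ⋆ g) ⋆ h) n ≈ (f ⋆ (g ⋆ h)) n
  ⋆-assoc f g h n = begin
    ∑ n (λ t → ∑ t (λ i → f i * g (t ∸ i)) * h (n ∸ t))
      ≈⟨ ∑-cong′ n (λ t → *-distribʳ-∑ t _ _) ⟩
    ∑ n (λ t → ∑ t (λ i → (f i * g (t ∸ i)) * h (n ∸ t)))
      ≈⟨ ∑-cong n (λ t t≤n → ∑-cong t (λ i i≤t → trans (*-assoc _ _ _)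
            (*-congˡ (*-congˡ (reflexive (≡.cong h (∸-split i≤t t≤n))))))) ⟩
    ∑ n (λ t → ∑ t (λ i → f i * (g (t ∸ i) * h (n ∸ i ∸ (t ∸ i)))))
      ≈⟨ sym (∑-triangle n (λ i j → f i * (g j * h (n ∸ i ∸ j)))) ⟩
    ∑ n (λ i → ∑ (n ∸ i) (λ j → f i * (g j * h (n ∸ i ∸ j))))
      ≈⟨ ∑-cong′ n (λ i → sym (*-distribˡ-∑ (n ∸ i) (f i) _)) ⟩
    ∑ n (λ i → f i * (g ⋆ h) (n ∸ i)) ∎
    where
    ∸-split : ∀ {i t n} → i ≤ t → t ≤ n → n ∸ t ≡ n ∸ i ∸ (t ∸ i)
    ∸-split {i} {t} {n} i≤t _ =
      ≡.trans (≡.cong (n ∸_) (≡.sym (ℕₚ.m+[n∸m]≡n i≤t))) (≡.sym (ℕₚ.∸-+-assoc n i (t ∸ i)))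

powerSeries : CommutativeSemiring 0ℓ 0ℓ → CommutativeSemiring 0ℓ 0ℓ
powerSeries R = record
  { Carrier = ℕ → Carrier
  ; _≈_     = λ f g → ∀ i → f i ≈ g i
  ; _+_     = λ f g i → f i + g i
  ; _*_     = _⋆_
  ; 0#      = λ _ → 0#
  ; 1#      = one
  ; isCommutativeSemiring = isCommutativeSemiringˡ record
    { +-isCommutativeMonoid = isCommutativeMonoidˡ record
      { isSemigroup = record
        { isMagma = record { isEquivalence = pointwise ; ∙-cong = λ p q i → +-cong (p i) (q i) }
        ; assoc   = λ f g h i → +-assoc (f i) (g i) (h i) }
      ; identityˡ = λ f i → +-identityˡ (f i)
      ; comm      = λ f g i → +-comm (f i) (g i) }
    ; *-isCommutativeMonoid = isCommutativeMonoidˡ record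
      { isSemigroup = record
        { isMagma = record { isEquivalence = pointwise ; ∙-cong = λ p q n → ∑-cong n (λ i _ → *-cong (p i) (q (n ∸ i))) }
        ; assoc   = ⋆-assoc }
      ; identityˡ = one-⋆
      ; comm      = ⋆-comm }
    ; distribʳ = λ h f g n → trans (∑-cong′ n (λ i → distribʳ (h (n ∸ i)) (f i) (g i))) (∑-distrib-+ n _ _)
    ; zeroˡ    = λ f n → ∑-zero n _ (λ i _ → zeroˡ (f (n ∸ i)))
    }
  }
  where
  open CommutativeSemiring R
  open Summation R
  open Convolution R
  pointwise : IsEquivalence (λ (f g : ℕ → Carrier) → ∀ i → f i ≈ g i)
  pointwise = record { refl = λ i → refl ; sym = λ p i → sym (p i) ; trans = λ p q i → trans (p i) (q i) }

module Monomials (R : CommutativeSemiring 0ℓ 0ℓ) where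
  open CommutativeSemiring R
  open Summation R
  module R[t] = CommutativeSemiring (powerSeries R)

  var : ℕ → Carrier
  var (suc zero) = 1#
  var _          = 0#

  const : Carrier → ℕ → Carrier
  const c zero    = c
  const c (suc _) = 0#

  var*-zero : ∀ f → (var R[t].* f) 0 ≈ 0#
  var*-zero f = zeroˡ (f 0)

  var*-suc : ∀ f n → (var R[t].* f) (suc n) ≈ f n
  var*-suc f n = trans (∑-split-head n _) (trans (+-cong (zeroˡ _) (shifted n)) (+-identityˡ _))
    where
    shifted : ∀ n → ∑ n (λ i → var (suc i) * f (n ∸ i)) ≈ f n
    shifted zero    = *-identityˡ _
    shifted (suc n) = trans (∑-split-head n _)
      (trans (+-cong (*-identityˡ _) (∑-zero n _ (λ i _ → zeroˡ _))) (+-identityʳ _))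

  const* : ∀ c f n → (const c R[t].* f) n ≈ c * f n
  const* c f zero    = refl
  const* c f (suc n) = trans (∑-split-head n _) (trans (+-congˡ (∑-zero n _ (λ i _ → zeroˡ _))) (+-identityʳ _))

-- Series in w, x, y, z

open import Defs
open import Data.Nat using (_+_; _*_; _≡ᵇ_; _<ᵇ_; _≤ᵇ_)

ℕ-semiring : CommutativeSemiring 0ℓ 0ℓ
ℕ-semiring = ℕₚ.+-*-commutativeSemiring

Series¹ Series² Series³ Series⁴ : CommutativeSemiring 0ℓ 0ℓ
Series¹ = powerSeries ℕ-semiring
Series² = powerSeries Series¹
Series³ = powerSeries Series²
Series⁴ = powerSeries Series³

module 𝕊¹ = CommutativeSemiring Series¹
module 𝕊² = CommutativeSemiring Series²
module 𝕊³ = CommutativeSemiring Series³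
module 𝕊 = CommutativeSemiring Series⁴
open Summation using (∑)
open 𝕊 using (_≈_)
open CommSemigroupProperties 𝕊.+-commutativeSemigroup using () renaming (interchange to ⊕-interchange)
open import Relation.Binary.Reasoning.Setoid 𝕊.setoid

∑-eval : ∀ R n (h : ℕ → CommutativeSemiring.Carrier (powerSeries R)) x →
  ∑ (powerSeries R) n h x ≡ ∑ R n (λ i → h i x)
∑-eval R zero    h x = ≡.refl
∑-eval R (suc n) h x = ≡.cong (λ s → CommutativeSemiring._+_ R s (h (suc n) x)) (∑-eval R n h x)

∑≡sumTo : ∀ n h → ∑ ℕ-semiring n h ≡ sumTo n h
∑≡sumTo zero    h = ≡.refl
∑≡sumTo (suc n) h = ≡.cong (_+ h (suc n)) (∑≡sumTo n h)

sumTo-cong : ∀ n {h h′ : ℕ → ℕ} → (∀ i → h i ≡ h′ i) → sumTo n h ≡ sumTo n h′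
sumTo-cong zero    e = e 0
sumTo-cong (suc n) e = ≡.cong₂ _+_ (sumTo-cong n e) (e (suc n))

*¹-coeff : ∀ f g d → (f 𝕊¹.* g) d ≡ sumTo d (λ l → f l * g (d ∸ l))
*¹-coeff f g d = ∑≡sumTo d _

*²-coeff : ∀ f g c d → (f 𝕊².* g) c d ≡ sumTo c (λ k → sumTo d (λ l → f k l * g (c ∸ k) (d ∸ l)))
*²-coeff f g c d = ≡.trans (∑-eval ℕ-semiring c _ d)
  (≡.trans (∑≡sumTo c _) (sumTo-cong c (λ k → *¹-coeff (f k) (g (c ∸ k)) d)))

*³-coeff : ∀ f g b c d → (f 𝕊³.* g) b c d ≡
  sumTo b (λ j → sumTo c (λ k → sumTo d (λ l → f j k l * g (b ∸ j) (c ∸ k) (d ∸ l))))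
*³-coeff f g b c d = ≡.trans (≡.cong (λ s → s d) (∑-eval Series¹ b _ c)) (≡.trans (∑-eval ℕ-semiring b _ d)
  (≡.trans (∑≡sumTo b _) (sumTo-cong b (λ j → *²-coeff (f j) (g (b ∸ j)) c d))))

⊗≈* : ∀ f g → f ⊗ g ≈ f 𝕊.* g
⊗≈* f g a b c d = ≡.sym (≡.trans (≡.cong (λ s → s c d) (∑-eval Series² a _ b))
  (≡.trans (≡.cong (λ s → s d) (∑-eval Series¹ a _ c)) (≡.trans (∑-eval ℕ-semiring a _ d)
  (≡.trans (∑≡sumTo a _) (sumTo-cong a (λ i → *³-coeff (f i) (g (a ∸ i)) b c d))))))

open import Algebra.Properties.Semiring.Mult 𝕊.semiring using (×-assoc-*) renaming (_×_ to _×ₙ_)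

⊗-cong : ∀ {f f′ g g′} → f ≈ f′ → g ≈ g′ → f ⊗ g ≈ f′ ⊗ g′
⊗-cong {f} {f′} {g} {g′} p q = 𝕊.trans (⊗≈* f g) (𝕊.trans (𝕊.*-cong p q) (𝕊.sym (⊗≈* f′ g′)))

⊗-congˡ : ∀ f {g g′} → g ≈ g′ → f ⊗ g ≈ f ⊗ g′
⊗-congˡ f = ⊗-cong {f} 𝕊.refl

⊗-congʳ : ∀ {f f′} g → f ≈ f′ → f ⊗ g ≈ f′ ⊗ g
⊗-congʳ g p = ⊗-cong p (𝕊.refl {g})

⊗-comm : ∀ f g → f ⊗ g ≈ g ⊗ f
⊗-comm f g = 𝕊.trans (⊗≈* f g) (𝕊.trans (𝕊.*-comm f g) (𝕊.sym (⊗≈* g f)))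

⊗-assoc : ∀ f g h → (f ⊗ g) ⊗ h ≈ f ⊗ (g ⊗ h)
⊗-assoc f g h = 𝕊.trans (⊗-congʳ h (⊗≈* f g)) (𝕊.trans (⊗≈* (f 𝕊.* g) h) (𝕊.trans (𝕊.*-assoc f g h)
  (𝕊.trans (𝕊.sym (⊗≈* f (g 𝕊.* h))) (⊗-congˡ f (𝕊.sym (⊗≈* g h))))))

⊗-distribʳ : ∀ f g h → (f ⊕ g) ⊗ h ≈ f ⊗ h ⊕ g ⊗ h
⊗-distribʳ f g h = 𝕊.trans (⊗≈* (f ⊕ g) h)
  (𝕊.trans (𝕊.distribʳ h f g) (𝕊.+-cong (𝕊.sym (⊗≈* f h)) (𝕊.sym (⊗≈* g h))))

⊗-distribˡ : ∀ h f g → h ⊗ (f ⊕ g) ≈ h ⊗ f ⊕ h ⊗ g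
⊗-distribˡ h f g = 𝕊.trans (⊗-comm h (f ⊕ g))
  (𝕊.trans (⊗-distribʳ f g h) (𝕊.+-cong (⊗-comm f h) (⊗-comm g h)))

⊗-zeroˡ : ∀ f → zeroS ⊗ f ≈ zeroS
⊗-zeroˡ f = 𝕊.trans (⊗≈* zeroS f) (𝕊.zeroˡ f)

⊗-zeroʳ : ∀ f → f ⊗ zeroS ≈ zeroS
⊗-zeroʳ f = 𝕊.trans (⊗-comm f zeroS) (⊗-zeroˡ f)

oneS≈1# : oneS ≈ 𝕊.1#
oneS≈1# zero    zero    zero    zero    = ≡.refl
oneS≈1# zero    zero    zero    (suc d) = ≡.refl
oneS≈1# zero    zero    (suc c) d       = ≡.refl
oneS≈1# zero    (suc b) c       d       = ≡.refl
oneS≈1# (suc a) b       c       d       = ≡.refl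

⊗-identityˡ : ∀ f → oneS ⊗ f ≈ f
⊗-identityˡ f = 𝕊.trans (⊗-congʳ f oneS≈1#) (𝕊.trans (⊗≈* 𝕊.1# f) (𝕊.*-identityˡ f))

·≈× : ∀ k f → k · f ≈ k ×ₙ f
·≈× zero    f a b c d = ≡.refl
·≈× (suc k) f a b c d = ≡.cong (f a b c d +_) (·≈× k f a b c d)

·-congˡ : ∀ k {f g} → f ≈ g → k · f ≈ k · g
·-congˡ k p a b c d = ≡.cong (k *_) (p a b c d)

⊗-·-assoc : ∀ k f g → (k · f) ⊗ g ≈ k · (f ⊗ g)
⊗-·-assoc k f g = 𝕊.trans (⊗-congʳ g (·≈× k f)) (𝕊.trans (⊗≈* (k ×ₙ f) g) (𝕊.trans (×-assoc-* k f g)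
  (𝕊.trans (𝕊.sym (·≈× k (f 𝕊.* g))) (·-congˡ k (𝕊.sym (⊗≈* f g))))))

module Mono⁰ = Monomials ℕ-semiring
module Mono¹ = Monomials Series¹
module Mono² = Monomials Series²
module Mono³ = Monomials Series³

wS≈var : wS ≈ Mono³.var
wS≈var zero                 b       c       d       = ≡.refl
wS≈var (suc zero)           zero    zero    zero    = ≡.refl
wS≈var (suc zero)           zero    zero    (suc d) = ≡.refl
wS≈var (suc zero)           zero    (suc c) d       = ≡.refl
wS≈var (suc zero)           (suc b) c       d       = ≡.refl
wS≈var (suc (suc a))        b       c       d       = ≡.refl

xS≈var : xS ≈ Mono³.const Mono².var
xS≈var zero    zero                 c       d       = ≡.refl
xS≈var zero    (suc zero)           zero    zero    = ≡.refl
xS≈var zero    (suc zero)           zero    (suc d) = ≡.refl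
xS≈var zero    (suc zero)           (suc c) d       = ≡.refl
xS≈var zero    (suc (suc b))        c       d       = ≡.refl
xS≈var (suc a) b                    c       d       = ≡.refl

yS≈var : yS ≈ Mono³.const (Mono².const Mono¹.var)
yS≈var zero    zero    zero          d       = ≡.refl
yS≈var zero    zero    (suc zero)    zero    = ≡.refl
yS≈var zero    zero    (suc zero)    (suc d) = ≡.refl
yS≈var zero    zero    (suc (suc c)) d       = ≡.refl
yS≈var zero    (suc b) c             d       = ≡.refl
yS≈var (suc a) b       c             d       = ≡.refl

zS≈var : zS ≈ Mono³.const (Mono².const (Mono¹.const Mono⁰.var))
zS≈var zero    zero    zero    zero          = ≡.refl
zS≈var zero    zero    zero    (suc zero)    = ≡.refl
zS≈var zero    zero    zero    (suc (suc d)) = ≡.refl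
zS≈var zero    zero    (suc c) d             = ≡.refl
zS≈var zero    (suc b) c       d             = ≡.refl
zS≈var (suc a) b       c       d             = ≡.refl

shiftʷ shiftˣ shiftʸ shiftᶻ : Series → Series
shiftʷ h zero    b c d = 0
shiftʷ h (suc a) b c d = h a b c d
shiftˣ h a zero    c d = 0
shiftˣ h a (suc b) c d = h a b c d
shiftʸ h a b zero    d = 0
shiftʸ h a b (suc c) d = h a b c d
shiftᶻ h a b c zero    = 0
shiftᶻ h a b c (suc d) = h a b c d

w⊗≈shiftʷ : ∀ h → wS ⊗ h ≈ shiftʷ h
w⊗≈shiftʷ h a b c d = ≡.trans (⊗-congʳ h wS≈var a b c d) (≡.trans (⊗≈* Mono³.var h a b c d) (shifted a))
  where
  shifted : ∀ a → (Mono³.var 𝕊.* h) a b c d ≡ shiftʷ h a b c d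
  shifted zero    = Mono³.var*-zero h b c d
  shifted (suc a) = Mono³.var*-suc h a b c d

x⊗≈shiftˣ : ∀ h → xS ⊗ h ≈ shiftˣ h
x⊗≈shiftˣ h a b c d = ≡.trans (⊗-congʳ h xS≈var a b c d) (≡.trans (⊗≈* (Mono³.const Mono².var) h a b c d)
  (≡.trans (Mono³.const* Mono².var h a b c d) (shifted b)))
  where
  shifted : ∀ b → (Mono².var 𝕊³.* h a) b c d ≡ shiftˣ h a b c d
  shifted zero    = Mono².var*-zero (h a) c d
  shifted (suc b) = Mono².var*-suc (h a) b c d

y⊗≈shiftʸ : ∀ h → yS ⊗ h ≈ shiftʸ h
y⊗≈shiftʸ h a b c d = ≡.trans (⊗-congʳ h yS≈var a b c d) (≡.trans (⊗≈* (Mono³.const y²) h a b c d)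
  (≡.trans (Mono³.const* y² h a b c d) (≡.trans (Mono².const* Mono¹.var (h a) b c d) (shifted c))))
  where
  y² : ℕ → ℕ → ℕ → ℕ
  y² = Mono².const Mono¹.var
  shifted : ∀ c → (Mono¹.var 𝕊².* h a b) c d ≡ shiftʸ h a b c d
  shifted zero    = Mono¹.var*-zero (h a b) d
  shifted (suc c) = Mono¹.var*-suc (h a b) c d

z⊗≈shiftᶻ : ∀ h → zS ⊗ h ≈ shiftᶻ h
z⊗≈shiftᶻ h a b c d = ≡.trans (⊗-congʳ h zS≈var a b c d) (≡.trans (⊗≈* (Mono³.const z²) h a b c d)
  (≡.trans (Mono³.const* z² h a b c d) (≡.trans (Mono².const* z¹ (h a) b c d)
  (≡.trans (Mono¹.const* Mono⁰.var (h a b) c d) (shifted d)))))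
  where
  z¹ : ℕ → ℕ → ℕ
  z¹ = Mono¹.const Mono⁰.var
  z² : ℕ → ℕ → ℕ → ℕ
  z² = Mono².const z¹
  shifted : ∀ d → (Mono⁰.var 𝕊¹.* h a b c) d ≡ shiftᶻ h a b c d
  shifted zero    = Mono⁰.var*-zero (h a b c)
  shifted (suc d) = Mono⁰.var*-suc (h a b c) d

linear : ℕ → ℕ → ℕ → ℕ → Series
linear p q r t = p · wS ⊕ q · xS ⊕ r · yS ⊕ t · zS

linearAction : ℕ → ℕ → ℕ → ℕ → Series → Series
linearAction p q r t h a b c d =
  p * shiftʷ h a b c d + q * shiftˣ h a b c d + r * shiftʸ h a b c d + t * shiftᶻ h a b c d

linear⊗≈linearAction : ∀ p q r t h → linear p q r t ⊗ h ≈ linearAction p q r t h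
linear⊗≈linearAction p q r t h a b c d =
  ≡.trans (⊗-distribʳ (p · wS ⊕ q · xS ⊕ r · yS) (t · zS) h a b c d)
  (≡.cong₂ _+_
    (≡.trans (⊗-distribʳ (p · wS ⊕ q · xS) (r · yS) h a b c d)
      (≡.cong₂ _+_
        (≡.trans (⊗-distribʳ (p · wS) (q · xS) h a b c d)
          (≡.cong₂ _+_ (scaled p wS shiftʷ w⊗≈shiftʷ) (scaled q xS shiftˣ x⊗≈shiftˣ)))
        (scaled r yS shiftʸ y⊗≈shiftʸ)))
    (scaled t zS shiftᶻ z⊗≈shiftᶻ))
  where
  scaled : ∀ k v (shift : Series → Series) → (∀ h → v ⊗ h ≈ shift h) →
    ((k · v) ⊗ h) a b c d ≡ k * shift h a b c d
  scaled k v shift v⊗ = ≡.trans (⊗-·-assoc k v h a b c d) (≡.cong (k *_) (v⊗ h a b c d))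

deg : ℕ → ℕ → ℕ → ℕ → ℕ
deg a b c d = a + b + c + d

deg-sucˣ : ∀ a b c d → deg a (suc b) c d ≡ suc (deg a b c d)
deg-sucˣ a b c d = ≡.cong (λ s → s + c + d) (ℕₚ.+-suc a b)

deg-sucʸ : ∀ a b c d → deg a b (suc c) d ≡ suc (deg a b c d)
deg-sucʸ a b c d = ≡.cong (_+ d) (ℕₚ.+-suc (a + b) c)

deg-sucᶻ : ∀ a b c d → deg a b c (suc d) ≡ suc (deg a b c d)
deg-sucᶻ a b c d = ℕₚ.+-suc (a + b + c) d

VanishesBelow : ℕ → Series → Set
VanishesBelow k h = ∀ a b c d → deg a b c d < k → h a b c d ≡ 0

linearAction-zeros : ∀ p q r t → p * 0 + q * 0 + r * 0 + t * 0 ≡ 0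
linearAction-zeros p q r t rewrite ℕₚ.*-zeroʳ p | ℕₚ.*-zeroʳ q | ℕₚ.*-zeroʳ r | ℕₚ.*-zeroʳ t = ≡.refl

linearAction-vanishesBelow : ∀ {k} p q r t {h} → VanishesBelow k h →
  VanishesBelow (suc k) (linearAction p q r t h)
linearAction-vanishesBelow {k} p q r t {h} v a b c d lt =
  ≡.trans (≡.cong₂ _+_ (≡.cong₂ _+_ (≡.cong₂ _+_ (≡.cong (p *_) (ʷ a lt)) (≡.cong (q *_) (ˣ b lt)))
          (≡.cong (r *_) (ʸ c lt))) (≡.cong (t *_) (ᶻ d lt)))
    (linearAction-zeros p q r t)
  where
  ʷ : ∀ a → deg a b c d < suc k → shiftʷ h a b c d ≡ 0
  ʷ zero    _          = ≡.refl
  ʷ (suc a) (s≤s lt)   = v a b c d lt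
  ˣ : ∀ b → deg a b c d < suc k → shiftˣ h a b c d ≡ 0
  ˣ zero    _  = ≡.refl
  ˣ (suc b) lt = v a b c d (ℕₚ.≤-pred (≡.subst (_< suc k) (deg-sucˣ a b c d) lt))
  ʸ : ∀ c → deg a b c d < suc k → shiftʸ h a b c d ≡ 0
  ʸ zero    _  = ≡.refl
  ʸ (suc c) lt = v a b c d (ℕₚ.≤-pred (≡.subst (_< suc k) (deg-sucʸ a b c d) lt))
  ᶻ : ∀ d → deg a b c d < suc k → shiftᶻ h a b c d ≡ 0
  ᶻ zero    _  = ≡.refl
  ᶻ (suc d) lt = v a b c d (ℕₚ.≤-pred (≡.subst (_< suc k) (deg-sucᶻ a b c d) lt))

linearAction-deg0 : ∀ p q r t h a b c d → deg a b c d ≡ 0 → linearAction p q r t h a b c d ≡ 0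
linearAction-deg0 p q r t h a b c d e =
  linearAction-vanishesBelow p q r t (λ _ _ _ _ ()) a b c d (≡.subst (_< 1) (≡.sym e) (s≤s z≤n))

module ℕ∑ = Summation ℕ-semiring

sumTo-cong≤ : ∀ n {h h′ : ℕ → ℕ} → (∀ i → i ≤ n → h i ≡ h′ i) → sumTo n h ≡ sumTo n h′
sumTo-cong≤ n {h} {h′} e = ≡.trans (≡.sym (∑≡sumTo n h)) (≡.trans (ℕ∑.∑-cong n e) (∑≡sumTo n h′))

sumTo-distrib-+ : ∀ n h g → sumTo n (λ i → h i + g i) ≡ sumTo n h + sumTo n g
sumTo-distrib-+ n h g = ≡.trans (≡.sym (∑≡sumTo n _))
  (≡.trans (ℕ∑.∑-distrib-+ n h g) (≡.cong₂ _+_ (∑≡sumTo n h) (∑≡sumTo n g)))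

*-distribˡ-sumTo : ∀ n k h → k * sumTo n h ≡ sumTo n (λ i → k * h i)
*-distribˡ-sumTo n k h = ≡.trans (≡.cong (k *_) (≡.sym (∑≡sumTo n h)))
  (≡.trans (ℕ∑.*-distribˡ-∑ n k h) (∑≡sumTo n _))

sumTo-zero : ∀ n h → (∀ i → h i ≡ 0) → sumTo n h ≡ 0
sumTo-zero n h e = ≡.trans (≡.sym (∑≡sumTo n h)) (ℕ∑.∑-zero n h (λ i _ → e i))

sumTo-split-head : ∀ n h → sumTo (suc n) h ≡ h 0 + sumTo n (λ i → h (suc i))
sumTo-split-head n h = ≡.trans (≡.sym (∑≡sumTo (suc n) h))
  (≡.trans (ℕ∑.∑-split-head n h) (≡.cong (h 0 +_) (∑≡sumTo n _)))

sumTo-trailing-zeros : ∀ m n h → (∀ i → m < i → h i ≡ 0) → m ≤ n → sumTo n h ≡ sumTo m h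
sumTo-trailing-zeros m zero    h e z≤n = ≡.refl
sumTo-trailing-zeros m (suc n) h e m≤n with ℕₚ.m≤n⇒m<n∨m≡n m≤n
... | inj₂ ≡.refl = ≡.refl
... | inj₁ m<n    = ≡.trans (≡.cong₂ _+_ (sumTo-trailing-zeros m n h e (ℕₚ.≤-pred m<n)) (e (suc n) m<n))
                            (ℕₚ.+-identityʳ _)

degreeSum : (ℕ → Series) → Series
degreeSum X a b c d = sumTo (deg a b c d) (λ k → X k a b c d)

linearAction-degreeSum : ∀ p q r t X D a b c d → deg a b c d ≡ suc D →
  linearAction p q r t (degreeSum X) a b c d ≡ sumTo D (λ k → linearAction p q r t (X k) a b c d)
linearAction-degreeSum p q r t X D a b c d e =
  ≡.trans (≡.cong₂ _+_ (≡.cong₂ _+_ (≡.cong₂ _+_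
      (≡.trans (≡.cong (p *_) (ʷ a e)) (*-distribˡ-sumTo D p _))
      (≡.trans (≡.cong (q *_) (ˣ b e)) (*-distribˡ-sumTo D q _)))
      (≡.trans (≡.cong (r *_) (ʸ c e)) (*-distribˡ-sumTo D r _)))
      (≡.trans (≡.cong (t *_) (ᶻ d e)) (*-distribˡ-sumTo D t _)))
  (≡.sym (≡.trans (sumTo-distrib-+ D _ _) (≡.cong (_+ _)
    (≡.trans (sumTo-distrib-+ D _ _) (≡.cong (_+ _) (sumTo-distrib-+ D _ _))))))
  where
  none : 0 ≡ sumTo D (λ _ → 0)
  none = ≡.sym (sumTo-zero D (λ _ → 0) (λ _ → ≡.refl))
  lower : ∀ {a′ b′ c′ d′} → deg a′ b′ c′ d′ ≡ D →
    sumTo (deg a′ b′ c′ d′) (λ k → X k a′ b′ c′ d′) ≡ sumTo D (λ k → X k a′ b′ c′ d′)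
  lower = ≡.cong (λ s → sumTo s _)
  ʷ : ∀ a → deg a b c d ≡ suc D → shiftʷ (degreeSum X) a b c d ≡ sumTo D (λ k → shiftʷ (X k) a b c d)
  ʷ zero    _ = none
  ʷ (suc a) e = lower (ℕₚ.suc-injective e)
  ˣ : ∀ b → deg a b c d ≡ suc D → shiftˣ (degreeSum X) a b c d ≡ sumTo D (λ k → shiftˣ (X k) a b c d)
  ˣ zero    _ = none
  ˣ (suc b) e = lower (ℕₚ.suc-injective (≡.trans (≡.sym (deg-sucˣ a b c d)) e))
  ʸ : ∀ c → deg a b c d ≡ suc D → shiftʸ (degreeSum X) a b c d ≡ sumTo D (λ k → shiftʸ (X k) a b c d)
  ʸ zero    _ = none
  ʸ (suc c) e = lower (ℕₚ.suc-injective (≡.trans (≡.sym (deg-sucʸ a b c d)) e))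
  ᶻ : ∀ d → deg a b c d ≡ suc D → shiftᶻ (degreeSum X) a b c d ≡ sumTo D (λ k → shiftᶻ (X k) a b c d)
  ᶻ zero    _ = none
  ᶻ (suc d) e = lower (ℕₚ.suc-injective (≡.trans (≡.sym (deg-sucᶻ a b c d)) e))

geometric-unfold : ∀ {u} p q r t → u ≈ linear p q r t → inv1- u ≈ oneS ⊕ u ⊗ inv1- u
geometric-unfold {u} p q r t u≈ a b c d with deg a b c d in e
... | zero  = ≡.trans (≡.sym (ℕₚ.+-identityʳ _)) (≡.cong (oneS a b c d +_) (≡.sym
    (≡.trans (⊗-congʳ (inv1- u) u≈ a b c d)
    (≡.trans (linear⊗≈linearAction p q r t (inv1- u) a b c d) (linearAction-deg0 p q r t _ a b c d e)))))
... | suc D = ≡.trans (sumTo-split-head D _) (≡.cong (oneS a b c d +_)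
    (≡.trans (sumTo-cong≤ D (λ k _ → power-suc k a b c d))
    (≡.sym (≡.trans (⊗-congʳ (inv1- u) u≈ a b c d) (≡.trans (linear⊗≈linearAction p q r t (inv1- u) a b c d)
      (linearAction-degreeSum p q r t (u ^ₛ_) D a b c d e))))))
  where
  power-suc : ∀ k → u ^ₛ suc k ≈ linearAction p q r t (u ^ₛ k)
  power-suc k = 𝕊.trans (⊗-congʳ (u ^ₛ k) u≈) (linear⊗≈linearAction p q r t (u ^ₛ k))


open Mono³ using (const)

-- Substituting a linear series for w

substW-as-degreeSum : ∀ s g → substW s g ≈ degreeSum (λ k → const (g k) ⊗ (s ^ₛ k))
substW-as-degreeSum s g a b c d = sumTo-cong (deg a b c d) (λ k → ≡.sym
  (≡.trans (⊗≈* (const (g k)) (s ^ₛ k) a b c d)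
  (≡.trans (Mono³.const* (g k) (s ^ₛ k) a b c d) (*³-coeff (g k) ((s ^ₛ k) a) b c d))))

degreeSum-cong : ∀ {X Y} → (∀ k → X k ≈ Y k) → degreeSum X ≈ degreeSum Y
degreeSum-cong e a b c d = sumTo-cong (deg a b c d) (λ k → e k a b c d)

substW-cong : ∀ s {f g} → f ≈ g → substW s f ≈ substW s g
substW-cong s {f} {g} e a b c d =
  sumTo-cong (deg a b c d) (λ k → sumTo-cong b (λ j → sumTo-cong c (λ l → sumTo-cong d (λ o →
    ≡.cong (_* (s ^ₛ k) a (b ∸ j) (c ∸ l) (d ∸ o)) (e k j l o)))))

substW-⊕ : ∀ s f g → substW s (f ⊕ g) ≈ substW s f ⊕ substW s g
substW-⊕ s f g = begin
  substW s (f ⊕ g)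
    ≈⟨ substW-as-degreeSum s (f ⊕ g) ⟩
  degreeSum (λ k → const ((f ⊕ g) k) ⊗ (s ^ₛ k))
    ≈⟨ degreeSum-cong (λ k → 𝕊.trans (⊗-congʳ (s ^ₛ k) (const-⊕ (f k) (g k)))
                                       (⊗-distribʳ (const (f k)) (const (g k)) (s ^ₛ k))) ⟩
  degreeSum (λ k → const (f k) ⊗ (s ^ₛ k) ⊕ const (g k) ⊗ (s ^ₛ k))
    ≈⟨ (λ a b c d → sumTo-distrib-+ (deg a b c d) _ _) ⟩
  degreeSum (λ k → const (f k) ⊗ (s ^ₛ k)) ⊕ degreeSum (λ k → const (g k) ⊗ (s ^ₛ k))
    ≈⟨ 𝕊.+-cong (𝕊.sym (substW-as-degreeSum s f)) (𝕊.sym (substW-as-degreeSum s g)) ⟩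
  substW s f ⊕ substW s g ∎
  where
  const-⊕ : ∀ f g → const (λ b c d → f b c d + g b c d) ≈ const f ⊕ const g
  const-⊕ f g zero    b c d = ≡.refl
  const-⊕ f g (suc a) b c d = ≡.refl

substW-· : ∀ s m f → substW s (m · f) ≈ m · substW s f
substW-· s m f = begin
  substW s (m · f)
    ≈⟨ substW-as-degreeSum s (m · f) ⟩
  degreeSum (λ k → const ((m · f) k) ⊗ (s ^ₛ k))
    ≈⟨ degreeSum-cong (λ k → 𝕊.trans (⊗-congʳ (s ^ₛ k) (const-· (f k))) (⊗-·-assoc m (const (f k)) (s ^ₛ k))) ⟩
  degreeSum (λ k → m · (const (f k) ⊗ (s ^ₛ k)))
    ≈⟨ (λ a b c d → ≡.sym (*-distribˡ-sumTo (deg a b c d) m _)) ⟩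
  m · degreeSum (λ k → const (f k) ⊗ (s ^ₛ k))
    ≈⟨ ·-congˡ m (𝕊.sym (substW-as-degreeSum s f)) ⟩
  m · substW s f ∎
  where
  const-· : ∀ f → const (λ b c d → m * f b c d) ≈ m · const f
  const-· f zero    b c d = ≡.refl
  const-· f (suc a) b c d = ≡.sym (ℕₚ.*-zeroʳ m)

substW-zeroS : ∀ s → substW s zeroS ≈ zeroS
substW-zeroS s a b c d =
  sumTo-zero (deg a b c d) _ (λ k → sumTo-zero b _ (λ j → sumTo-zero c _ (λ l → sumTo-zero d _ (λ o → ≡.refl))))

substW-oneS : ∀ s → substW s oneS ≈ oneS
substW-oneS s a b c d = ≡.trans (substW-as-degreeSum s oneS a b c d)
  (≡.trans (sumTo-trailing-zeros 0 (deg a b c d) _ higher z≤n)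
  (≡.trans (⊗-congʳ oneS constant-term a b c d) (⊗-identityˡ oneS a b c d)))
  where
  constant-term : const (oneS 0) ≈ oneS
  constant-term zero    b c d = ≡.refl
  constant-term (suc a) b c d = ≡.refl
  no-constant : ∀ i → const (oneS (suc i)) ≈ zeroS
  no-constant i zero    b c d = ≡.refl
  no-constant i (suc a) b c d = ≡.refl
  higher : ∀ i → 0 < i → (const (oneS i) ⊗ (s ^ₛ i)) a b c d ≡ 0
  higher (suc i) _ = ≡.trans (⊗-congʳ (s ^ₛ suc i) (no-constant i) a b c d) (⊗-zeroˡ (s ^ₛ suc i) a b c d)

vanishesBelow-cong : ∀ {k f g} → f ≈ g → VanishesBelow k f → VanishesBelow k g
vanishesBelow-cong f≈g v a b c d lt = ≡.trans (≡.sym (f≈g a b c d)) (v a b c d lt)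

module _ {u : Series} (p q r t : ℕ) (u≈ : u ≈ linear p q r t) where

  u⊗≈linearAction : ∀ h → u ⊗ h ≈ linearAction p q r t h
  u⊗≈linearAction h = 𝕊.trans (⊗-congʳ h u≈) (linear⊗≈linearAction p q r t h)

  linear⊗-vanishesBelow : ∀ {k h} → VanishesBelow k h → VanishesBelow (suc k) (u ⊗ h)
  linear⊗-vanishesBelow {h = h} v =
    vanishesBelow-cong (𝕊.sym (u⊗≈linearAction h)) (linearAction-vanishesBelow p q r t v)

  linear⊗degreeSum : ∀ {X} → (∀ k → VanishesBelow k (X k)) → u ⊗ degreeSum X ≈ degreeSum (λ k → u ⊗ X k)
  linear⊗degreeSum {X} vX a b c d with deg a b c d in e
  ... | zero  = ≡.trans (u⊗≈linearAction (degreeSum X) a b c d) (≡.trans (linearAction-deg0 p q r t _ a b c d e)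
      (≡.sym (linear⊗-vanishesBelow (vX 0) a b c d (≡.subst (_< 1) (≡.sym e) (s≤s z≤n)))))
  ... | suc D = ≡.trans (u⊗≈linearAction (degreeSum X) a b c d) (≡.trans (linearAction-degreeSum p q r t X D a b c d e)
      (≡.sym (≡.trans (sumTo-trailing-zeros D (suc D) _ beyond (ℕₚ.n≤1+n D))
        (sumTo-cong D (λ k → u⊗≈linearAction (X k) a b c d)))))
    where
    beyond : ∀ i → D < i → (u ⊗ X i) a b c d ≡ 0
    beyond i D<i = linear⊗-vanishesBelow (vX i) a b c d (≡.subst (_< suc i) (≡.sym e) (s≤s D<i))

degreeSum-unshift : ∀ {T Z} → (∀ k → VanishesBelow (suc k) (Z k)) → T 0 ≈ zeroS → (∀ k → T (suc k) ≈ Z k) →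
  degreeSum T ≈ degreeSum Z
degreeSum-unshift {T} {Z} vZ T0 T-suc a b c d with deg a b c d in e
... | zero  = ≡.trans (T0 a b c d) (≡.sym (vZ 0 a b c d (≡.subst (_< 1) (≡.sym e) (s≤s z≤n))))
... | suc D = ≡.trans (sumTo-split-head D _) (≡.trans (≡.cong₂ _+_ (T0 a b c d) (sumTo-cong D (λ k → T-suc k a b c d)))
    (≡.sym (sumTo-trailing-zeros D (suc D) _ beyond (ℕₚ.n≤1+n D))))
  where
  beyond : ∀ i → D < i → Z i a b c d ≡ 0
  beyond i D<i = vZ i a b c d (≡.subst (_< suc i) (≡.sym e) (s≤s D<i))

const-wFree⊗ : ∀ q r t f k → const ((linear 0 q r t ⊗ f) k) ≈ linear 0 q r t ⊗ const (f k)
const-wFree⊗ q r t f k zero b c d =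
  ≡.trans (linear⊗≈linearAction 0 q r t f k b c d) (≡.sym (≡.trans (linear⊗≈linearAction 0 q r t (const (f k)) 0 b c d)
    (≡.cong₂ _+_ (≡.cong₂ _+_ (≡.cong (q *_) (ˣ b)) (≡.cong (r *_) (ʸ c))) (≡.cong (t *_) (ᶻ d)))))
  where
  ˣ : ∀ b → shiftˣ (const (f k)) 0 b c d ≡ shiftˣ f k b c d
  ˣ zero    = ≡.refl
  ˣ (suc b) = ≡.refl
  ʸ : ∀ c → shiftʸ (const (f k)) 0 b c d ≡ shiftʸ f k b c d
  ʸ zero    = ≡.refl
  ʸ (suc c) = ≡.refl
  ᶻ : ∀ d → shiftᶻ (const (f k)) 0 b c d ≡ shiftᶻ f k b c d
  ᶻ zero    = ≡.refl
  ᶻ (suc d) = ≡.refl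
const-wFree⊗ q r t f k (suc i) b c d = ≡.sym (≡.trans (linear⊗≈linearAction 0 q r t (const (f k)) (suc i) b c d)
  (≡.trans (≡.cong₂ _+_ (≡.cong₂ _+_ (≡.cong (q *_) (ˣ b)) (≡.cong (r *_) (ʸ c))) (≡.cong (t *_) (ᶻ d)))
    (linearAction-zeros 0 q r t)))
  where
  ˣ : ∀ b → shiftˣ (const (f k)) (suc i) b c d ≡ 0
  ˣ zero    = ≡.refl
  ˣ (suc b) = ≡.refl
  ʸ : ∀ c → shiftʸ (const (f k)) (suc i) b c d ≡ 0
  ʸ zero    = ≡.refl
  ʸ (suc c) = ≡.refl
  ᶻ : ∀ d → shiftᶻ (const (f k)) (suc i) b c d ≡ 0
  ᶻ zero    = ≡.refl
  ᶻ (suc d) = ≡.refl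

module LinearSubstitution {s : Series} (p q r t : ℕ) (s≈ : s ≈ linear p q r t) where

  term : Series → ℕ → Series
  term f k = const (f k) ⊗ (s ^ₛ k)

  power⊗-vanishesBelow : ∀ k Z → VanishesBelow k ((s ^ₛ k) ⊗ Z)
  power⊗-vanishesBelow zero    Z = λ _ _ _ _ ()
  power⊗-vanishesBelow (suc k) Z = vanishesBelow-cong (𝕊.sym (⊗-assoc s (s ^ₛ k) Z))
    (linear⊗-vanishesBelow p q r t s≈ (power⊗-vanishesBelow k Z))

  term-vanishesBelow : ∀ f k → VanishesBelow k (term f k)
  term-vanishesBelow f k =
    vanishesBelow-cong (⊗-comm (s ^ₛ k) (const (f k))) (power⊗-vanishesBelow k (const (f k)))

  substW-w⊗ : ∀ f → substW s (wS ⊗ f) ≈ s ⊗ substW s f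
  substW-w⊗ f = begin
    substW s (wS ⊗ f)        ≈⟨ substW-as-degreeSum s (wS ⊗ f) ⟩
    degreeSum (term (wS ⊗ f)) ≈⟨ degreeSum-unshift (λ k → linear⊗-vanishesBelow p q r t s≈ (term-vanishesBelow f k))
                                    term-zero term-suc ⟩
    degreeSum (λ k → s ⊗ term f k) ≈⟨ 𝕊.sym (linear⊗degreeSum p q r t s≈ (term-vanishesBelow f)) ⟩
    s ⊗ degreeSum (term f)   ≈⟨ ⊗-congˡ s (𝕊.sym (substW-as-degreeSum s f)) ⟩
    s ⊗ substW s f ∎
    where
    const-w⊗-zero : const ((wS ⊗ f) 0) ≈ zeroS
    const-w⊗-zero zero    b c d = w⊗≈shiftʷ f 0 b c d
    const-w⊗-zero (suc a) b c d = ≡.refl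
    const-w⊗-suc : ∀ k → const ((wS ⊗ f) (suc k)) ≈ const (f k)
    const-w⊗-suc k zero    b c d = w⊗≈shiftʷ f (suc k) b c d
    const-w⊗-suc k (suc a) b c d = ≡.refl
    term-zero : term (wS ⊗ f) 0 ≈ zeroS
    term-zero = 𝕊.trans (⊗-congʳ oneS const-w⊗-zero) (⊗-zeroˡ oneS)
    term-suc : ∀ k → term (wS ⊗ f) (suc k) ≈ s ⊗ term f k
    term-suc k = 𝕊.trans (⊗-congʳ (s ^ₛ suc k) (const-w⊗-suc k)) (𝕊.trans (⊗-comm (const (f k)) (s ⊗ (s ^ₛ k)))
      (𝕊.trans (⊗-assoc s (s ^ₛ k) (const (f k))) (⊗-congˡ s (⊗-comm (s ^ₛ k) (const (f k))))))

  substW-wFree⊗ : ∀ q′ r′ t′ f → substW s (linear 0 q′ r′ t′ ⊗ f) ≈ linear 0 q′ r′ t′ ⊗ substW s f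
  substW-wFree⊗ q′ r′ t′ f = begin
    substW s (ℓ ⊗ f)                ≈⟨ substW-as-degreeSum s (ℓ ⊗ f) ⟩
    degreeSum (term (ℓ ⊗ f))        ≈⟨ degreeSum-cong (λ k → 𝕊.trans (⊗-congʳ (s ^ₛ k) (const-wFree⊗ q′ r′ t′ f k))
                                                                      (⊗-assoc ℓ (const (f k)) (s ^ₛ k))) ⟩
    degreeSum (λ k → ℓ ⊗ term f k)  ≈⟨ 𝕊.sym (linear⊗degreeSum 0 q′ r′ t′ 𝕊.refl (term-vanishesBelow f)) ⟩
    ℓ ⊗ degreeSum (term f)          ≈⟨ ⊗-congˡ ℓ (𝕊.sym (substW-as-degreeSum s f)) ⟩
    ℓ ⊗ substW s f ∎
    where
    ℓ : Series
    ℓ = linear 0 q′ r′ t′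

  substW-linear⊗ : ∀ p′ q′ r′ t′ f →
    substW s (linear p′ q′ r′ t′ ⊗ f) ≈ (p′ · s ⊕ linear 0 q′ r′ t′) ⊗ substW s f
  substW-linear⊗ p′ q′ r′ t′ f = begin
    substW s (linear p′ q′ r′ t′ ⊗ f)
      ≈⟨ substW-cong s (𝕊.trans (⊗-congʳ f split) (𝕊.trans (⊗-distribʳ (p′ · wS) ℓ f)
                                                    (𝕊.+-cong (⊗-·-assoc p′ wS f) (𝕊.refl {ℓ ⊗ f})))) ⟩
    substW s (p′ · (wS ⊗ f) ⊕ ℓ ⊗ f)
      ≈⟨ substW-⊕ s (p′ · (wS ⊗ f)) (ℓ ⊗ f) ⟩
    substW s (p′ · (wS ⊗ f)) ⊕ substW s (ℓ ⊗ f)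
      ≈⟨ 𝕊.+-cong (𝕊.trans (substW-· s p′ (wS ⊗ f)) (·-congˡ p′ (substW-w⊗ f))) (substW-wFree⊗ q′ r′ t′ f) ⟩
    p′ · (s ⊗ substW s f) ⊕ ℓ ⊗ substW s f
      ≈⟨ 𝕊.+-cong (𝕊.sym (⊗-·-assoc p′ s (substW s f))) (𝕊.refl {ℓ ⊗ substW s f}) ⟩
    (p′ · s) ⊗ substW s f ⊕ ℓ ⊗ substW s f
      ≈⟨ 𝕊.sym (⊗-distribʳ (p′ · s) ℓ (substW s f)) ⟩
    (p′ · s ⊕ ℓ) ⊗ substW s f ∎
    where
    ℓ : Series
    ℓ = linear 0 q′ r′ t′
    split : linear p′ q′ r′ t′ ≈ p′ · wS ⊕ ℓ
    split a b c d = ≡.trans (≡.cong (_+ t′ * zS a b c d) (ℕₚ.+-assoc (p′ * wS a b c d) _ _)) (ℕₚ.+-assoc (p′ * wS a b c d) _ _)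

-- The recursion over exploration states

≡ᵇ⇒≡ : ∀ {m n} → (m ≡ᵇ n) ≡ true → m ≡ n
≡ᵇ⇒≡ {m} {n} e = ℕₚ.≡ᵇ⇒≡ m n (≡.subst T (≡.sym e) _)

≡ᵇ-refl : ∀ n → (n ≡ᵇ n) ≡ true
≡ᵇ-refl zero    = ≡.refl
≡ᵇ-refl (suc n) = ≡ᵇ-refl n

≢⇒≡ᵇ-false : ∀ {m n} → m ≢ n → (m ≡ᵇ n) ≡ false
≢⇒≡ᵇ-false {m} {n} m≢n with m ≡ᵇ n in e
... | true  = ⊥-elim (m≢n (≡ᵇ⇒≡ e))
... | false = ≡.refl

<ᵇ⇒< : ∀ {m n} → (m <ᵇ n) ≡ true → m < n
<ᵇ⇒< {m} {n} e = ℕₚ.<ᵇ⇒< m n (≡.subst T (≡.sym e) _)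

<⇒<ᵇ-true : ∀ {m n} → m < n → (m <ᵇ n) ≡ true
<⇒<ᵇ-true {m} {n} m<n with m <ᵇ n | ℕₚ.<⇒<ᵇ m<n
... | true | _ = ≡.refl

≥⇒<ᵇ-false : ∀ {m n} → n ≤ m → (m <ᵇ n) ≡ false
≥⇒<ᵇ-false {m} {n} n≤m with m <ᵇ n in e
... | true  = ⊥-elim (ℕₚ.<⇒≱ (<ᵇ⇒< e) n≤m)
... | false = ≡.refl

≤ᵇ-false⇒> : ∀ {m n} → (m ≤ᵇ n) ≡ false → n < m
≤ᵇ-false⇒> {m} {n} e = ℕₚ.≰⇒> (λ m≤n → ≡.subst T e (ℕₚ.≤⇒≤ᵇ m≤n))

<ᵇ-false⇒≥ : ∀ {m n} → (m <ᵇ n) ≡ false → n ≤ m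
<ᵇ-false⇒≥ {m} {n} e = ℕₚ.≮⇒≥ (λ m<n → ≡.subst T e (ℕₚ.<⇒<ᵇ m<n))

onlyIf : Bool → Series → Series
onlyIf true  f = f
onlyIf false f = zeroS

top : List ℕ → ℕ
top []      = 0
top (x ∷ _) = x

Chain : ℕ → List ℕ → Set
Chain c []          = ⊥
Chain c (x ∷ [])    = x ≡ c
Chain c (x ∷ y ∷ r) = y < x × Chain c (y ∷ r)

ValidState : ℕ → ℕ → List ℕ → Set
ValidState n k p = Chain 1 p × top p ≤ k × k ≤ n

-- From the top u of the active path q, with 1, …, k discovered: a loop, a forward arc to one of
-- the k ∸ u descendants u+1, …, k, a back arc to one of the other length q ∸ 1 vertices of q,
-- or a cross arc to one of the remaining u ∸ length q vertices below u.
arcWeight : ℕ → List ℕ → Series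
arcWeight k q = linear 1 (k ∸ top q) (length q ∸ 1) (top q ∸ length q)

sumSuffixes : List ℕ → (List ℕ → Series) → Series
sumSuffixes []       F = zeroS
sumSuffixes (x ∷ xs) F = F (x ∷ xs) ⊕ sumSuffixes xs F

arcFrom : ℕ → (ℕ → List ℕ → Series) → ℕ → List ℕ → Series
arcFrom n X k q = arcWeight k q ⊗ X k q ⊕ onlyIf (k <ᵇ n) (X (suc k) (suc k ∷ q))

unfold : ℕ → (ℕ → List ℕ → Series) → ℕ → List ℕ → Series
unfold n X k p = onlyIf (k ≡ᵇ n) oneS ⊕ sumSuffixes p (arcFrom n X k)

Solves : ℕ → (ℕ → List ℕ → Series) → Set
Solves n X = ∀ k p → ValidState n k p → X k p ≈ unfold n X k p

validState-tail : ∀ {n k x y r} → ValidState n k (x ∷ y ∷ r) → ValidState n k (y ∷ r)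
validState-tail ((y<x , ch) , x≤k , k≤n) = ch , ℕₚ.≤-trans (ℕₚ.<⇒≤ y<x) x≤k , k≤n

validState-child : ∀ {n k q} → ValidState n k q → k < n → ValidState n (suc k) (suc k ∷ q)
validState-child {q = []}    (() , _)
validState-child {q = x ∷ r} (ch , x≤k , _) k<n = (s≤s x≤k , ch) , ℕₚ.≤-refl , k<n

sumSuffixes-congᵛ : ∀ {n k} p {F G : List ℕ → Series} {a b c d} → ValidState n k p →
  (∀ q → ValidState n k q → F q a b c d ≡ G q a b c d) → sumSuffixes p F a b c d ≡ sumSuffixes p G a b c d
sumSuffixes-congᵛ []          (() , _)
sumSuffixes-congᵛ (x ∷ [])    V e = ≡.cong (_+ 0) (e (x ∷ []) V)
sumSuffixes-congᵛ (x ∷ y ∷ r) V e = ≡.cong₂ _+_ (e _ V) (sumSuffixes-congᵛ (y ∷ r) (validState-tail V) e)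

AgreeBelow : ℕ → Series → Series → Set
AgreeBelow m h h′ = ∀ a b c d → deg a b c d < m → h a b c d ≡ h′ a b c d

linearAction-cong< : ∀ p q r t {h h′} a b c d → AgreeBelow (deg a b c d) h h′ →
  linearAction p q r t h a b c d ≡ linearAction p q r t h′ a b c d
linearAction-cong< p q r t {h} {h′} a b c d e =
  ≡.cong₂ _+_ (≡.cong₂ _+_ (≡.cong₂ _+_ (≡.cong (p *_) (ʷ a e)) (≡.cong (q *_) (ˣ b e))) (≡.cong (r *_) (ʸ c e)))
    (≡.cong (t *_) (ᶻ d e))
  where
  lower : ∀ {m n} → n ≡ suc m → m < n
  lower {m} e′ = ≡.subst (m <_) (≡.sym e′) (ℕₚ.n<1+n m)
  ʷ : ∀ a → AgreeBelow (deg a b c d) h h′ → shiftʷ h a b c d ≡ shiftʷ h′ a b c d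
  ʷ zero    _ = ≡.refl
  ʷ (suc a) e = e a b c d ℕₚ.≤-refl
  ˣ : ∀ b → AgreeBelow (deg a b c d) h h′ → shiftˣ h a b c d ≡ shiftˣ h′ a b c d
  ˣ zero    _ = ≡.refl
  ˣ (suc b) e = e a b c d (lower (deg-sucˣ a b c d))
  ʸ : ∀ c → AgreeBelow (deg a b c d) h h′ → shiftʸ h a b c d ≡ shiftʸ h′ a b c d
  ʸ zero    _ = ≡.refl
  ʸ (suc c) e = e a b c d (lower (deg-sucʸ a b c d))
  ᶻ : ∀ d → AgreeBelow (deg a b c d) h h′ → shiftᶻ h a b c d ≡ shiftᶻ h′ a b c d
  ᶻ zero    _ = ≡.refl
  ᶻ (suc d) e = e a b c d (lower (deg-sucᶻ a b c d))

-- By induction on (n ∸ k) + degree: a non-tree arc raises the degree, a tree arc raises k.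
solution-unique : ∀ {n X Y} → Solves n X → Solves n Y → ∀ k p → ValidState n k p → X k p ≈ Y k p
solution-unique {n} {X} {Y} solX solY k p V a b c d = below (suc (n ∸ k + deg a b c d)) k p V a b c d ℕₚ.≤-refl
  where
  below : ∀ M k p → ValidState n k p → ∀ a b c d → n ∸ k + deg a b c d < M → X k p a b c d ≡ Y k p a b c d
  below (suc M) k p V a b c d (s≤s le) =
    ≡.trans (solX k p V a b c d) (≡.trans (≡.cong (onlyIf (k ≡ᵇ n) oneS a b c d +_)
      (sumSuffixes-congᵛ p V summand)) (≡.sym (solY k p V a b c d)))
    where
    summand : ∀ q → ValidState n k q → arcFrom n X k q a b c d ≡ arcFrom n Y k q a b c d
    summand q Vq = ≡.cong₂ _+_
      (≡.trans (linear⊗≈linearAction 1 F B C (X k q) a b c d) (≡.trans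
        (linearAction-cong< 1 F B C a b c d (λ a′ b′ c′ d′ lt →
          below M k q Vq a′ b′ c′ d′ (ℕₚ.<-≤-trans (ℕₚ.+-monoʳ-< (n ∸ k) lt) le)))
        (≡.sym (linear⊗≈linearAction 1 F B C (Y k q) a b c d))))
      (child (k <ᵇ n) ≡.refl)
      where
      F B C : ℕ
      F = k ∸ top q
      B = length q ∸ 1
      C = top q ∸ length q
      child : ∀ b′ → (k <ᵇ n) ≡ b′ →
        onlyIf b′ (X (suc k) (suc k ∷ q)) a b c d ≡ onlyIf b′ (Y (suc k) (suc k ∷ q)) a b c d
      child false _   = ≡.refl
      child true  k<n = below M (suc k) (suc k ∷ q) (validState-child Vq (<ᵇ⇒< k<n)) a b c d
        (ℕₚ.<-≤-trans (ℕₚ.+-monoˡ-< (deg a b c d) (ℕₚ.∸-monoʳ-< {n} (ℕₚ.n<1+n k) (<ᵇ⇒< k<n))) le)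

sumSuffixes-cong : ∀ p {F G : List ℕ → Series} → (∀ q → F q ≈ G q) → sumSuffixes p F ≈ sumSuffixes p G
sumSuffixes-cong []      e = 𝕊.refl
sumSuffixes-cong (x ∷ p) e = 𝕊.+-cong (e (x ∷ p)) (sumSuffixes-cong p e)

sumSuffixes-⊕ : ∀ p (F G : List ℕ → Series) → sumSuffixes p (λ q → F q ⊕ G q) ≈ sumSuffixes p F ⊕ sumSuffixes p G
sumSuffixes-⊕ []      F G = 𝕊.sym (𝕊.+-identityʳ zeroS)
sumSuffixes-⊕ (x ∷ p) F G = 𝕊.trans (𝕊.+-congˡ (sumSuffixes-⊕ p F G))
  (⊕-interchange (F (x ∷ p)) (G (x ∷ p)) (sumSuffixes p F) (sumSuffixes p G))

⊗-distribʳ-sumSuffixes : ∀ p (F : List ℕ → Series) H → sumSuffixes p F ⊗ H ≈ sumSuffixes p (λ q → F q ⊗ H)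
⊗-distribʳ-sumSuffixes []      F H = ⊗-zeroˡ H
⊗-distribʳ-sumSuffixes (x ∷ p) F H =
  𝕊.trans (⊗-distribʳ (F (x ∷ p)) (sumSuffixes p F) H) (𝕊.+-congˡ (⊗-distribʳ-sumSuffixes p F H))

substW-sumSuffixes : ∀ s p (F : List ℕ → Series) → substW s (sumSuffixes p F) ≈ sumSuffixes p (λ q → substW s (F q))
substW-sumSuffixes s []      F = substW-zeroS s
substW-sumSuffixes s (x ∷ p) F =
  𝕊.trans (substW-⊕ s (F (x ∷ p)) (sumSuffixes p F)) (𝕊.+-congˡ (substW-sumSuffixes s p F))

sumSuffixes-zero : ∀ p (F : List ℕ → Series) {a b c d} → (∀ q → F q a b c d ≡ 0) → sumSuffixes p F a b c d ≡ 0
sumSuffixes-zero []      F e = ≡.refl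
sumSuffixes-zero (x ∷ p) F e = ≡.cong₂ _+_ (e (x ∷ p)) (sumSuffixes-zero p F e)

onlyIf-⊗ : ∀ b F H → onlyIf b F ⊗ H ≈ onlyIf b (F ⊗ H)
onlyIf-⊗ true  F H = 𝕊.refl
onlyIf-⊗ false F H = ⊗-zeroˡ H

substW-onlyIf : ∀ s b F → substW s (onlyIf b F) ≈ onlyIf b (substW s F)
substW-onlyIf s true  F = 𝕊.refl
substW-onlyIf s false F = substW-zeroS s

onlyIf-⊕ : ∀ b F G → onlyIf b (F ⊕ G) ≈ onlyIf b F ⊕ onlyIf b G
onlyIf-⊕ true  F G = 𝕊.refl
onlyIf-⊕ false F G = 𝕊.sym (𝕊.+-identityˡ zeroS)

onlyIf-cong : ∀ b {F G} → F ≈ G → onlyIf b F ≈ onlyIf b G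
onlyIf-cong true  e = e
onlyIf-cong false e = 𝕊.refl

onlyIf-≡ : ∀ {b b′} F → b ≡ b′ → onlyIf b F ≈ onlyIf b′ F
onlyIf-≡ F ≡.refl = 𝕊.refl

sumS1-cong : ∀ K {F G : ℕ → Series} → (∀ m → 1 ≤ m → m ≤ K → F m ≈ G m) → sumS1 K F ≈ sumS1 K G
sumS1-cong zero    e = 𝕊.refl
sumS1-cong (suc K) e =
  𝕊.+-cong (sumS1-cong K (λ m 1≤m m≤K → e m 1≤m (ℕₚ.m≤n⇒m≤1+n m≤K))) (e (suc K) (s≤s z≤n) ℕₚ.≤-refl)

sumS1-⊕ : ∀ K (F G : ℕ → Series) → sumS1 K (λ m → F m ⊕ G m) ≈ sumS1 K F ⊕ sumS1 K G
sumS1-⊕ zero    F G = 𝕊.sym (𝕊.+-identityˡ zeroS)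
sumS1-⊕ (suc K) F G = 𝕊.trans (𝕊.+-congʳ (sumS1-⊕ K F G))
  (⊕-interchange (sumS1 K F) (sumS1 K G) (F (suc K)) (G (suc K)))

⊗-distribˡ-sumS1 : ∀ K (F : ℕ → Series) H → H ⊗ sumS1 K F ≈ sumS1 K (λ m → H ⊗ F m)
⊗-distribˡ-sumS1 zero    F H = ⊗-zeroʳ H
⊗-distribˡ-sumS1 (suc K) F H =
  𝕊.trans (⊗-distribˡ H (sumS1 K F) (F (suc K))) (𝕊.+-congʳ (⊗-distribˡ-sumS1 K F H))

sumS1-zero : ∀ K (F : ℕ → Series) → (∀ m → 1 ≤ m → m ≤ K → F m ≈ zeroS) → sumS1 K F ≈ zeroS
sumS1-zero zero    F e = 𝕊.refl
sumS1-zero (suc K) F e = 𝕊.trans (𝕊.+-cong (sumS1-zero K F (λ m 1≤m m≤K → e m 1≤m (ℕₚ.m≤n⇒m≤1+n m≤K)))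
  (e (suc K) (s≤s z≤n) ℕₚ.≤-refl)) (𝕊.+-identityˡ zeroS)

sumS1-sumSuffixes : ∀ K p (F : ℕ → List ℕ → Series) →
  sumS1 K (λ m → sumSuffixes p (F m)) ≈ sumSuffixes p (λ q → sumS1 K (λ m → F m q))
sumS1-sumSuffixes K []      F = sumS1-zero K _ (λ _ _ _ → 𝕊.refl)
sumS1-sumSuffixes K (x ∷ p) F =
  𝕊.trans (sumS1-⊕ K (λ m → F m (x ∷ p)) (λ m → sumSuffixes p (F m))) (𝕊.+-congˡ (sumS1-sumSuffixes K p F))

sumS1-delta : ∀ K k (F : ℕ → Series) → 1 ≤ k → sumS1 K (λ m → onlyIf (k ≡ᵇ m) (F m)) ≈ onlyIf (k ≤ᵇ K) (F k)
sumS1-delta zero    (suc k) F _   = 𝕊.refl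
sumS1-delta (suc K) k       F 1≤k with k ≟ suc K
... | yes ≡.refl = 𝕊.trans
      (𝕊.+-cong (𝕊.trans (sumS1-delta K (suc K) F 1≤k) (onlyIf-≡ (F (suc K)) (≥⇒<ᵇ-false {K} ℕₚ.≤-refl)))
                (onlyIf-≡ (F (suc K)) (≡ᵇ-refl K)))
      (𝕊.trans (𝕊.+-identityˡ (F (suc K))) (onlyIf-≡ (F (suc K)) (≡.sym (<⇒<ᵇ-true (ℕₚ.n<1+n K)))))
... | no k≢1+K = 𝕊.trans
      (𝕊.+-cong (sumS1-delta K k F 1≤k) (onlyIf-≡ (F (suc K)) (≢⇒≡ᵇ-false k≢1+K)))
      (𝕊.trans (𝕊.+-identityʳ (onlyIf (k ≤ᵇ K) (F k))) (onlyIf-≡ (F k) (≤ᵇ-suc k K k≢1+K)))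
  where
  ≤ᵇ-suc : ∀ k K → k ≢ suc K → (k ≤ᵇ K) ≡ (k ≤ᵇ suc K)
  ≤ᵇ-suc zero          K       _ = ≡.refl
  ≤ᵇ-suc (suc zero)    zero    k≢1+K = ⊥-elim (k≢1+K ≡.refl)
  ≤ᵇ-suc (suc zero)    (suc K) _ = ≡.refl
  ≤ᵇ-suc (suc (suc k)) zero    _ = ≡.refl
  ≤ᵇ-suc (suc (suc k)) (suc K) k≢1+K = ≤ᵇ-suc (suc k) K (λ e → k≢1+K (≡.cong suc e))

chain-bottom≤top : ∀ {c} p → Chain c p → c ≤ top p
chain-bottom≤top []          ()
chain-bottom≤top (x ∷ [])    ≡.refl    = ℕₚ.≤-refl
chain-bottom≤top (x ∷ y ∷ r) (y<x , ch) = ℕₚ.≤-trans (chain-bottom≤top (y ∷ r) ch) (ℕₚ.<⇒≤ y<x)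

chain-length : ∀ {c} q → Chain c q → c + length q ≤ suc (top q)
chain-length []                ()
chain-length {c} (x ∷ [])    ≡.refl     = ≡.subst (_≤ suc x) (ℕₚ.+-comm 1 x) ℕₚ.≤-refl
chain-length {c} (x ∷ y ∷ r) (y<x , ch) =
  ≡.subst (_≤ suc x) (≡.sym (ℕₚ.+-suc c (length (y ∷ r)))) (s≤s (ℕₚ.≤-trans (chain-length (y ∷ r) ch) y<x))

chain-map-∸ : ∀ m q → Chain (suc m) q → Chain 1 (map (_∸ m) q)
chain-map-∸ m []          ()
chain-map-∸ m (x ∷ [])    ≡.refl     = ℕₚ.m+n∸n≡m 1 m
chain-map-∸ m (x ∷ y ∷ r) (y<x , ch) =
  ℕₚ.∸-monoˡ-< y<x (ℕₚ.<⇒≤ (chain-bottom≤top (y ∷ r) ch)) , chain-map-∸ m (y ∷ r) ch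

lastOf : List ℕ → ℕ
lastOf []          = 0
lastOf (x ∷ [])    = x
lastOf (x ∷ y ∷ r) = lastOf (y ∷ r)

dropLast : List ℕ → List ℕ
dropLast []          = []
dropLast (x ∷ [])    = []
dropLast (x ∷ y ∷ r) = x ∷ dropLast (y ∷ r)

lastOf-chain : ∀ {c} q → Chain c q → lastOf q ≡ c
lastOf-chain []          ()
lastOf-chain (x ∷ [])    ≡.refl  = ≡.refl
lastOf-chain (x ∷ y ∷ r) (_ , ch) = lastOf-chain (y ∷ r) ch

dropLast-++ : ∀ r x → dropLast (r ++ [ x ]) ≡ r
dropLast-++ []          x = ≡.refl
dropLast-++ (y ∷ [])    x = ≡.refl
dropLast-++ (y ∷ z ∷ r) x = ≡.cong (y ∷_) (dropLast-++ (z ∷ r) x)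

sumSuffixes-++ : ∀ p x (F : List ℕ → Series) →
  sumSuffixes (p ++ [ x ]) F ≈ sumSuffixes p (λ r → F (r ++ [ x ])) ⊕ F [ x ]
sumSuffixes-++ []      x F = 𝕊.+-comm (F [ x ]) zeroS
sumSuffixes-++ (y ∷ p) x F = 𝕊.trans (𝕊.+-congˡ (sumSuffixes-++ p x F))
  (𝕊.sym (𝕊.+-assoc (F (y ∷ p ++ [ x ])) (sumSuffixes p (λ r → F (r ++ [ x ]))) (F [ x ])))

sumSuffixes-map : ∀ f q (H : List ℕ → Series) → sumSuffixes (map f q) H ≈ sumSuffixes q (λ r → H (map f r))
sumSuffixes-map f []      H = 𝕊.refl
sumSuffixes-map f (x ∷ q) H = 𝕊.+-congˡ (sumSuffixes-map f q H)

sumSuffixes-congᶜ : ∀ {c} p {F G : List ℕ → Series} → Chain c p →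
  (∀ q → Chain c q → top q ≤ top p → F q ≈ G q) → sumSuffixes p F ≈ sumSuffixes p G
sumSuffixes-congᶜ []          ()         e
sumSuffixes-congᶜ (x ∷ [])    ch         e = 𝕊.+-congʳ (e _ ch ℕₚ.≤-refl)
sumSuffixes-congᶜ (x ∷ y ∷ r) (y<x , ch) e = 𝕊.+-cong (e _ (y<x , ch) ℕₚ.≤-refl)
  (sumSuffixes-congᶜ (y ∷ r) ch (λ q cq q≤y → e q cq (ℕₚ.≤-trans q≤y (ℕₚ.<⇒≤ y<x))))

-- An explicit solution

subtreeSubst : ℕ → Series
subtreeSubst m = wS ⊕ yS ⊕ (m ∸ 1) · zS

subtreeSubst-linear : ∀ m → subtreeSubst m ≈ linear 1 0 1 (m ∸ 1)
subtreeSubst-linear m a b c d = identity (wS a b c d) (xS a b c d) (yS a b c d) (zS a b c d) (m ∸ 1)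
  where
  identity : ∀ w x y z M → w + y + M * z ≡ 1 * w + 0 * x + 1 * y + M * z
  identity = solve-∀

subtreeSubst-absorb : ∀ m {X Y Z X′ Y′ Z′} → X′ ≡ X → 1 + Y′ ≡ Y → (m ∸ 1) + Z′ ≡ Z →
  1 · subtreeSubst m ⊕ linear 0 X′ Y′ Z′ ≈ linear 1 X Y Z
subtreeSubst-absorb m {X′ = X′} {Y′} {Z′} ≡.refl ≡.refl ≡.refl a b c d =
  identity (wS a b c d) (xS a b c d) (yS a b c d) (zS a b c d) (m ∸ 1) X′ Y′ Z′
  where
  identity : ∀ w x y z M X′ Y′ Z′ →
    1 * (w + y + M * z) + (0 * w + X′ * x + Y′ * y + Z′ * z) ≡ 1 * w + X′ * x + (1 + Y′) * y + (M + Z′) * z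
  identity = solve-∀

∸-∸-cancel : ∀ k h m → m ≤ h → (k ∸ m) ∸ (h ∸ m) ≡ k ∸ h
∸-∸-cancel k h m m≤h = ≡.trans (ℕₚ.∸-+-assoc k m (h ∸ m)) (≡.cong (k ∸_) (ℕₚ.m+[n∸m]≡n m≤h))

cross-count : ∀ h m L → 1 ≤ m → m + L ≤ h → (m ∸ 1) + ((h ∸ m) ∸ L) ≡ h ∸ (L + 1)
cross-count h m L 1≤m m+L≤h = ≡.trans (≡.sym (ℕₚ.m+n∸n≡m X (L + 1))) (≡.cong (_∸ (L + 1)) X+L+1≡h)
  where
  X : ℕ
  X = (m ∸ 1) + ((h ∸ m) ∸ L)
  L≤h∸m : L ≤ h ∸ m
  L≤h∸m = ≡.subst (_≤ h ∸ m) (ℕₚ.m+n∸m≡n m L) (ℕₚ.∸-monoˡ-≤ m m+L≤h)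
  regroup : ∀ A B L → A + B + (L + 1) ≡ (A + 1) + (B + L)
  regroup = solve-∀
  X+L+1≡h : X + (L + 1) ≡ h
  X+L+1≡h = ≡.trans (regroup (m ∸ 1) (h ∸ m ∸ L) L) (≡.trans (≡.cong₂ _+_ (ℕₚ.m∸n+n≡m 1≤m) (ℕₚ.m∸n+n≡m L≤h∸m))
    (ℕₚ.m+[n∸m]≡n (ℕₚ.≤-trans (ℕₚ.m≤m+n m L) m+L≤h)))

-- Inside the subtree of the root's child m+1, relabelled by v ↦ v ∸ m: a back arc to the root and a
-- cross arc to one of 2, …, m are both counted as loops of the relabelled exploration, which is
-- exactly what substituting w ↦ w + y + (m ∸ 1) z records.
substW-arcWeight : ∀ m k r → 1 ≤ m → Chain (suc m) r → top r ≤ k → ∀ X →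
  substW (subtreeSubst m) (arcWeight (k ∸ m) (map (_∸ m) r) ⊗ X) ≈ arcWeight k (r ++ [ 1 ]) ⊗ substW (subtreeSubst m) X
substW-arcWeight m k []      1≤m ()
substW-arcWeight m k (x ∷ r) 1≤m ch x≤k X = 𝕊.trans
  (LinearSubstitution.substW-linear⊗ 1 0 1 (m ∸ 1) (subtreeSubst-linear m) 1
    ((k ∸ m) ∸ (x ∸ m)) (length (map (_∸ m) (x ∷ r)) ∸ 1) ((x ∸ m) ∸ length (map (_∸ m) (x ∷ r))) X)
  (⊗-congʳ (substW (subtreeSubst m) X) (subtreeSubst-absorb m forwards backs crosses))
  where
  L : ℕ
  L = length (x ∷ r)
  length-map : length (map (_∸ m) (x ∷ r)) ≡ L
  length-map = Listₚ.length-map (_∸ m) (x ∷ r)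
  length-++ : length ((x ∷ r) ++ [ 1 ]) ≡ L + 1
  length-++ = Listₚ.length-++ (x ∷ r)
  forwards : (k ∸ m) ∸ (x ∸ m) ≡ k ∸ x
  forwards = ∸-∸-cancel k x m (ℕₚ.<⇒≤ (chain-bottom≤top (x ∷ r) ch))
  backs : 1 + (length (map (_∸ m) (x ∷ r)) ∸ 1) ≡ length ((x ∷ r) ++ [ 1 ]) ∸ 1
  backs = ≡.trans (≡.cong (λ l → 1 + (l ∸ 1)) length-map)
    (≡.trans (≡.sym (≡.cong (_∸ 1) (ℕₚ.+-comm L 1))) (≡.cong (_∸ 1) (≡.sym length-++)))
  crosses : (m ∸ 1) + ((x ∸ m) ∸ length (map (_∸ m) (x ∷ r))) ≡ x ∸ length ((x ∷ r) ++ [ 1 ])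
  crosses = ≡.trans (≡.cong (λ l → (m ∸ 1) + ((x ∸ m) ∸ l)) length-map)
    (≡.trans (cross-count x m L 1≤m (ℕₚ.≤-pred (chain-length (x ∷ r) ch))) (≡.cong (x ∸_) (≡.sym length-++)))

≡ᵇ-∸ : ∀ m k n → m ≤ k → m ≤ n → ((k ∸ m) ≡ᵇ (n ∸ m)) ≡ (k ≡ᵇ n)
≡ᵇ-∸ zero    k       n       _         _         = ≡.refl
≡ᵇ-∸ (suc m) (suc k) (suc n) (s≤s m≤k) (s≤s m≤n) = ≡ᵇ-∸ m k n m≤k m≤n

<ᵇ-∸ : ∀ m k n → m ≤ k → m ≤ n → ((k ∸ m) <ᵇ (n ∸ m)) ≡ (k <ᵇ n)
<ᵇ-∸ zero    k       n       _         _         = ≡.refl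
<ᵇ-∸ (suc m) (suc k) (suc n) (s≤s m≤k) (s≤s m≤n) = <ᵇ-∸ m k n m≤k m≤n

-- 'beforeLast': the root's last child m + 1 is not discovered yet (summed over m);
-- 'afterLast': it is, and the exploration continues inside its subtree.
module Decomposition (n : ℕ) (Φ : ℕ → ℕ → List ℕ → Series) (solΦ : ∀ N → Solves N (Φ N)) where

  rootTail : Series
  rootTail = inv1- (wS ⊕ (n ∸ 1) · xS)

  inSubtree : ℕ → ℕ → List ℕ → Series
  inSubtree m k r = substW (subtreeSubst m) (Φ (n ∸ m) (k ∸ m) (map (_∸ m) r)) ⊗ rootTail

  afterLast : ℕ → List ℕ → Series
  afterLast k []          = zeroS
  afterLast k (x ∷ [])    = onlyIf (k ≡ᵇ n) rootTail
  afterLast k (x ∷ y ∷ r) = inSubtree (lastOf (dropLast (x ∷ y ∷ r)) ∸ 1) k (dropLast (x ∷ y ∷ r))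

  lastChild : ℕ → Series
  lastChild m = afterLast (suc m) (suc m ∷ [ 1 ])

  beforeLast : ℕ → List ℕ → Series
  beforeLast k p = sumS1 (n ∸ 1) (λ m → onlyIf (k ≤ᵇ m) (Φ m k p ⊗ lastChild m))

  explicit : ℕ → List ℕ → Series
  explicit k p = beforeLast k p ⊕ afterLast k p

  beforeLast-term : ∀ k p m → ValidState n k p →
    onlyIf (k ≤ᵇ m) (Φ m k p ⊗ lastChild m) ≈
    onlyIf (k ≡ᵇ m) (lastChild m) ⊕ sumSuffixes p (λ q → arcWeight k q ⊗ onlyIf (k ≤ᵇ m) (Φ m k q ⊗ lastChild m)
                                                    ⊕ onlyIf (suc k ≤ᵇ m) (Φ m (suc k) (suc k ∷ q) ⊗ lastChild m))
  beforeLast-term k p m (ch , p≤k , _) with k ≤ᵇ m in k≤ᵇm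
  ... | true = begin
    Φ m k p ⊗ Ψ
      ≈⟨ ⊗-congʳ Ψ (solΦ m k p (ch , p≤k , ℕₚ.≤ᵇ⇒≤ k m (≡.subst T (≡.sym k≤ᵇm) _))) ⟩
    unfold m (Φ m) k p ⊗ Ψ
      ≈⟨ ⊗-distribʳ (onlyIf (k ≡ᵇ m) oneS) _ Ψ ⟩
    onlyIf (k ≡ᵇ m) oneS ⊗ Ψ ⊕ sumSuffixes p Gₘ ⊗ Ψ
      ≈⟨ 𝕊.+-cong (𝕊.trans (onlyIf-⊗ (k ≡ᵇ m) oneS Ψ) (onlyIf-cong (k ≡ᵇ m) (⊗-identityˡ Ψ)))
                  (𝕊.trans (⊗-distribʳ-sumSuffixes p Gₘ Ψ) (sumSuffixes-cong p distribute)) ⟩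
    onlyIf (k ≡ᵇ m) Ψ ⊕ sumSuffixes p H ∎
    where
    Ψ : Series
    Ψ = lastChild m
    Gₘ H : List ℕ → Series
    Gₘ = arcFrom m (Φ m) k
    H q = arcWeight k q ⊗ (Φ m k q ⊗ Ψ) ⊕ onlyIf (k <ᵇ m) (Φ m (suc k) (suc k ∷ q) ⊗ Ψ)
    distribute : ∀ q → Gₘ q ⊗ Ψ ≈ H q
    distribute q = 𝕊.trans (⊗-distribʳ (arcWeight k q ⊗ Φ m k q) _ Ψ)
      (𝕊.+-cong (⊗-assoc (arcWeight k q) (Φ m k q) Ψ) (onlyIf-⊗ (k <ᵇ m) _ Ψ))
  ... | false rewrite ≢⇒≡ᵇ-false (ℕₚ.>⇒≢ (≤ᵇ-false⇒> {k} {m} k≤ᵇm))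
                    | ≥⇒<ᵇ-false {k} (ℕₚ.<⇒≤ (≤ᵇ-false⇒> {k} {m} k≤ᵇm)) =
    λ a b c d → ≡.sym (sumSuffixes-zero p _ (λ q →
      ≡.trans (ℕₚ.+-identityʳ _) (⊗-zeroʳ (arcWeight k q) a b c d)))

  beforeLast-unfold : ∀ k p → ValidState n k p →
    beforeLast k p ≈ onlyIf (k <ᵇ n) (lastChild k)
                     ⊕ sumSuffixes p (λ q → arcWeight k q ⊗ beforeLast k q ⊕ beforeLast (suc k) (suc k ∷ q))
  beforeLast-unfold k p V@(ch , p≤k , _) = begin
    beforeLast k p
      ≈⟨ sumS1-cong (n ∸ 1) (λ m _ _ → beforeLast-term k p m V) ⟩
    sumS1 (n ∸ 1) (λ m → onlyIf (k ≡ᵇ m) (lastChild m) ⊕ sumSuffixes p (F m))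
      ≈⟨ sumS1-⊕ (n ∸ 1) _ _ ⟩
    sumS1 (n ∸ 1) (λ m → onlyIf (k ≡ᵇ m) (lastChild m)) ⊕ sumS1 (n ∸ 1) (λ m → sumSuffixes p (F m))
      ≈⟨ 𝕊.+-cong (𝕊.trans (sumS1-delta (n ∸ 1) k lastChild 1≤k) (onlyIf-≡ (lastChild k) (≤ᵇ-pred k n 1≤k)))
                  (𝕊.trans (sumS1-sumSuffixes (n ∸ 1) p F) (sumSuffixes-cong p regroup)) ⟩
    onlyIf (k <ᵇ n) (lastChild k) ⊕ sumSuffixes p (λ q → arcWeight k q ⊗ beforeLast k q ⊕ beforeLast (suc k) (suc k ∷ q)) ∎
    where
    F : ℕ → List ℕ → Series
    F m q = arcWeight k q ⊗ onlyIf (k ≤ᵇ m) (Φ m k q ⊗ lastChild m) ⊕ onlyIf (suc k ≤ᵇ m) (Φ m (suc k) (suc k ∷ q) ⊗ lastChild m)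
    1≤k : 1 ≤ k
    1≤k = ℕₚ.≤-trans (chain-bottom≤top p ch) p≤k
    ≤ᵇ-pred : ∀ k n → 1 ≤ k → (k ≤ᵇ n ∸ 1) ≡ (k <ᵇ n)
    ≤ᵇ-pred (suc k) zero    _ = ≡.refl
    ≤ᵇ-pred (suc k) (suc n) _ = ≡.refl
    regroup : ∀ q → sumS1 (n ∸ 1) (λ m → F m q) ≈ arcWeight k q ⊗ beforeLast k q ⊕ beforeLast (suc k) (suc k ∷ q)
    regroup q = 𝕊.trans (sumS1-⊕ (n ∸ 1) _ _) (𝕊.+-congʳ (𝕊.sym (⊗-distribˡ-sumS1 (n ∸ 1) _ (arcWeight k q))))

  substW-arcFrom : ∀ m k r → 1 ≤ m → Chain (suc m) r → top r ≤ k → k ≤ n →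
    substW (subtreeSubst m) (arcFrom (n ∸ m) (Φ (n ∸ m)) (k ∸ m) (map (_∸ m) r))
      ≈ arcWeight k (r ++ [ 1 ]) ⊗ substW (subtreeSubst m) (Φ (n ∸ m) (k ∸ m) (map (_∸ m) r))
        ⊕ onlyIf (k <ᵇ n) (substW (subtreeSubst m) (Φ (n ∸ m) (suc k ∸ m) (map (_∸ m) (suc k ∷ r))))
  substW-arcFrom m k []      1≤m ()
  substW-arcFrom m k (x ∷ r) 1≤m ch x≤k k≤n =
    𝕊.trans (substW-⊕ σ (arcWeight k′ r′ ⊗ Φ n′ k′ r′) (onlyIf (k′ <ᵇ n′) child)) (𝕊.+-cong
      (substW-arcWeight m k (x ∷ r) 1≤m ch x≤k (Φ n′ k′ r′))
      (𝕊.trans (substW-onlyIf σ (k′ <ᵇ n′) child)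
        (𝕊.trans (onlyIf-≡ (substW σ child) (<ᵇ-∸ m k n m≤k (ℕₚ.≤-trans m≤k k≤n)))
          (onlyIf-cong (k <ᵇ n) (𝕊.reflexive
            (≡.cong (λ j → substW σ (Φ n′ j (j ∷ r′))) (≡.sym (ℕₚ.+-∸-assoc 1 m≤k))))))))
    where
    σ : Series
    σ = subtreeSubst m
    k′ n′ : ℕ
    k′ = k ∸ m
    n′ = n ∸ m
    r′ : List ℕ
    r′ = map (_∸ m) (x ∷ r)
    child : Series
    child = Φ n′ (suc k′) (suc k′ ∷ r′)
    m≤k : m ≤ k
    m≤k = ℕₚ.≤-trans (ℕₚ.<⇒≤ (chain-bottom≤top (x ∷ r) ch)) x≤k

  inSubtree-unfold : ∀ m k p₀ → 1 ≤ m → Chain (suc m) p₀ → top p₀ ≤ k → k ≤ n →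
    inSubtree m k p₀ ≈ onlyIf (k ≡ᵇ n) rootTail
      ⊕ sumSuffixes p₀ (λ r → arcWeight k (r ++ [ 1 ]) ⊗ inSubtree m k r ⊕ onlyIf (k <ᵇ n) (inSubtree m (suc k) (suc k ∷ r)))
  inSubtree-unfold m k []       1≤m ()
  inSubtree-unfold m k p₀@(x ∷ _) 1≤m ch x≤k k≤n = begin
    inSubtree m k p₀
      ≈⟨ ⊗-congʳ rootTail (substW-cong σ (solΦ (n ∸ m) (k ∸ m) (map (_∸ m) p₀) shifted-valid)) ⟩
    substW σ (unfold (n ∸ m) (Φ (n ∸ m)) (k ∸ m) (map (_∸ m) p₀)) ⊗ rootTail
      ≈⟨ ⊗-congʳ rootTail (𝕊.trans (substW-⊕ σ (onlyIf (k′ ≡ᵇ n′) oneS) (sumSuffixes (map (_∸ m) p₀) G′)) (𝕊.+-cong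
           (𝕊.trans (substW-onlyIf σ (k′ ≡ᵇ n′) oneS)
             (𝕊.trans (onlyIf-cong (k′ ≡ᵇ n′) (substW-oneS σ)) (onlyIf-≡ oneS (≡ᵇ-∸ m k n m≤k m≤n))))
           (𝕊.trans (substW-sumSuffixes σ (map (_∸ m) p₀) G′)
             (𝕊.trans (sumSuffixes-map (_∸ m) p₀ (λ q → substW σ (G′ q))) (sumSuffixes-congᶜ p₀ ch (λ r ch-r r≤x →
               substW-arcFrom m k r 1≤m ch-r (ℕₚ.≤-trans r≤x x≤k) k≤n)))))) ⟩
    (onlyIf (k ≡ᵇ n) oneS ⊕ sumSuffixes p₀ H) ⊗ rootTail
      ≈⟨ 𝕊.trans (⊗-distribʳ (onlyIf (k ≡ᵇ n) oneS) (sumSuffixes p₀ H) rootTail) (𝕊.+-cong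
           (𝕊.trans (onlyIf-⊗ (k ≡ᵇ n) oneS rootTail) (onlyIf-cong (k ≡ᵇ n) (⊗-identityˡ rootTail)))
           (𝕊.trans (⊗-distribʳ-sumSuffixes p₀ H rootTail) (sumSuffixes-cong p₀ finish))) ⟩
    onlyIf (k ≡ᵇ n) rootTail
      ⊕ sumSuffixes p₀ (λ r → arcWeight k (r ++ [ 1 ]) ⊗ inSubtree m k r ⊕ onlyIf (k <ᵇ n) (inSubtree m (suc k) (suc k ∷ r))) ∎
    where
    σ : Series
    σ = subtreeSubst m
    k′ n′ : ℕ
    k′ = k ∸ m
    n′ = n ∸ m
    G′ : List ℕ → Series
    G′ = arcFrom n′ (Φ n′) k′
    m≤k : m ≤ k
    m≤k = ℕₚ.≤-trans (ℕₚ.<⇒≤ (chain-bottom≤top p₀ ch)) x≤k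
    m≤n : m ≤ n
    m≤n = ℕₚ.≤-trans m≤k k≤n
    shifted-valid : ValidState (n ∸ m) (k ∸ m) (map (_∸ m) p₀)
    shifted-valid = chain-map-∸ m p₀ ch , ℕₚ.∸-monoˡ-≤ m x≤k , ℕₚ.∸-monoˡ-≤ m k≤n
    H : List ℕ → Series
    H r = arcWeight k (r ++ [ 1 ]) ⊗ substW σ (Φ n′ k′ (map (_∸ m) r))
        ⊕ onlyIf (k <ᵇ n) (substW σ (Φ n′ (suc k ∸ m) (map (_∸ m) (suc k ∷ r))))
    finish : ∀ r → H r ⊗ rootTail ≈ arcWeight k (r ++ [ 1 ]) ⊗ inSubtree m k r ⊕ onlyIf (k <ᵇ n) (inSubtree m (suc k) (suc k ∷ r))
    finish r = 𝕊.trans (⊗-distribʳ (arcWeight k (r ++ [ 1 ]) ⊗ here) (onlyIf (k <ᵇ n) child) rootTail)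
      (𝕊.+-cong (⊗-assoc (arcWeight k (r ++ [ 1 ])) here rootTail) (onlyIf-⊗ (k <ᵇ n) child rootTail))
      where
      here : Series
      here = substW σ (Φ n′ k′ (map (_∸ m) r))
      child : Series
      child = substW σ (Φ n′ (suc k ∸ m) (map (_∸ m) (suc k ∷ r)))

  rootTail-unfold : ∀ k → onlyIf (k ≡ᵇ n) rootTail ≈ onlyIf (k ≡ᵇ n) oneS ⊕ arcWeight k [ 1 ] ⊗ onlyIf (k ≡ᵇ n) rootTail
  rootTail-unfold k with k ≡ᵇ n in k≡ᵇn
  ... | true rewrite ≡ᵇ⇒≡ {k} {n} k≡ᵇn =
    𝕊.trans (geometric-unfold 1 (n ∸ 1) 0 0 root-linear) (𝕊.+-congˡ (⊗-congʳ rootTail root-linear))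
    where
    root-linear : wS ⊕ (n ∸ 1) · xS ≈ linear 1 (n ∸ 1) 0 0
    root-linear a b c d = identity (wS a b c d) (xS a b c d) (yS a b c d) (zS a b c d) (n ∸ 1)
      where
      identity : ∀ w x y z M → w + M * x ≡ 1 * w + M * x + 0 * y + 0 * z
      identity = solve-∀
  ... | false = 𝕊.sym (𝕊.trans (𝕊.+-identityˡ _) (⊗-zeroʳ (arcWeight k [ 1 ])))

  afterLast-++ : ∀ m k x q → Chain (suc m) (x ∷ q) → afterLast k ((x ∷ q) ++ [ 1 ]) ≈ inSubtree m k (x ∷ q)
  afterLast-++ m k x q ch =
    ≡.subst₂ (λ m′ p′ → afterLast k ((x ∷ q) ++ [ 1 ]) ≈ inSubtree m′ k p′) last-child path (by-definition q)
    where
    p₀ : List ℕ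
    p₀ = dropLast ((x ∷ q) ++ [ 1 ])
    by-definition : ∀ q → afterLast k ((x ∷ q) ++ [ 1 ])
      ≈ inSubtree (lastOf (dropLast ((x ∷ q) ++ [ 1 ])) ∸ 1) k (dropLast ((x ∷ q) ++ [ 1 ]))
    by-definition []      = 𝕊.refl
    by-definition (_ ∷ _) = 𝕊.refl
    path : p₀ ≡ x ∷ q
    path = dropLast-++ (x ∷ q) 1
    last-child : lastOf p₀ ∸ 1 ≡ m
    last-child = ≡.cong (_∸ 1) (≡.trans (≡.cong lastOf path) (lastOf-chain (x ∷ q) ch))

  afterLast-unfold-root : ∀ k → onlyIf (k <ᵇ n) (lastChild k) ⊕ afterLast k [ 1 ] ≈ unfold n afterLast k [ 1 ]
  afterLast-unfold-root k a b c d = ≡.trans (≡.cong (L +_) (rootTail-unfold k a b c d))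
    (rearrange L (onlyIf (k ≡ᵇ n) oneS a b c d) ((arcWeight k [ 1 ] ⊗ onlyIf (k ≡ᵇ n) rootTail) a b c d))
    where
    L : ℕ
    L = onlyIf (k <ᵇ n) (lastChild k) a b c d
    rearrange : ∀ L I W → L + (I + W) ≡ I + ((W + L) + 0)
    rearrange = solve-∀

  afterLast-unfold-subtree : ∀ m k x q → 1 ≤ m → Chain (suc m) (x ∷ q) → x ≤ k → k ≤ n →
    onlyIf (k <ᵇ n) (lastChild k) ⊕ afterLast k ((x ∷ q) ++ [ 1 ]) ≈ unfold n afterLast k ((x ∷ q) ++ [ 1 ])
  afterLast-unfold-subtree m k x q 1≤m ch x≤k k≤n a b c d =
    ≡.trans (≡.cong (L +_) (≡.trans (afterLast-++ m k x q ch a b c d) (inSubtree-unfold m k (x ∷ q) 1≤m ch x≤k k≤n a b c d)))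
    (≡.trans (≡.cong (λ t → L + (t + S)) (rootTail-unfold k a b c d))
    (≡.trans (rearrange L I W S)
    (≡.sym (≡.cong (I +_) (≡.trans (sumSuffixes-++ (x ∷ q) 1 F a b c d)
      (≡.cong (_+ (W + L)) (≡.sym (sumSuffixes-congᶜ (x ∷ q) ch relabel a b c d))))))))
    where
    F : List ℕ → Series
    F = arcFrom n afterLast k
    F′ : List ℕ → Series
    F′ r = arcWeight k (r ++ [ 1 ]) ⊗ inSubtree m k r ⊕ onlyIf (k <ᵇ n) (inSubtree m (suc k) (suc k ∷ r))
    L I W S : ℕ
    L = onlyIf (k <ᵇ n) (lastChild k) a b c d
    I = onlyIf (k ≡ᵇ n) oneS a b c d
    W = (arcWeight k [ 1 ] ⊗ onlyIf (k ≡ᵇ n) rootTail) a b c d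
    S = sumSuffixes (x ∷ q) F′ a b c d
    rearrange : ∀ L I W S → L + ((I + W) + S) ≡ I + (S + (W + L))
    rearrange = solve-∀
    relabel : ∀ r → Chain (suc m) r → top r ≤ x → F′ r ≈ F (r ++ [ 1 ])
    relabel []      ()
    relabel (y ∷ r) ch-r y≤x = 𝕊.+-cong
      (⊗-congˡ (arcWeight k ((y ∷ r) ++ [ 1 ])) (𝕊.sym (afterLast-++ m k y r ch-r)))
      (onlyIf-cong (k <ᵇ n) (𝕊.sym (afterLast-++ m (suc k) (suc k) (y ∷ r) (s≤s (ℕₚ.≤-trans y≤x x≤k) , ch-r))))

  split-root : ∀ x y r → Chain 1 (x ∷ y ∷ r) →
    ∃[ m ] ∃[ q ] 1 ≤ m × Chain (suc m) (x ∷ q) × x ∷ y ∷ r ≡ (x ∷ q) ++ [ 1 ]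
  split-root (suc zero)    y []      (s≤s () , ≡.refl)
  split-root (suc (suc x)) y []      (_ , ≡.refl) = suc x , [] , s≤s z≤n , ≡.refl , ≡.refl
  split-root x             y (z ∷ r) (y<x , ch) with split-root y z r ch
  ... | m , q , 1≤m , ch-q , eq = m , y ∷ q , 1≤m , (y<x , ch-q) , ≡.cong (x ∷_) eq

  afterLast-unfold : ∀ k p → ValidState n k p → onlyIf (k <ᵇ n) (lastChild k) ⊕ afterLast k p ≈ unfold n afterLast k p
  afterLast-unfold k []          (() , _)
  afterLast-unfold k (x ∷ [])    (≡.refl , _) = afterLast-unfold-root k
  afterLast-unfold k (x ∷ y ∷ r) (ch , x≤k , k≤n) with split-root x y r ch
  ... | m , q , 1≤m , ch-q , eq = ≡.subst (λ p → onlyIf (k <ᵇ n) (lastChild k) ⊕ afterLast k p ≈ unfold n afterLast k p)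
      (≡.sym eq) (afterLast-unfold-subtree m k x q 1≤m ch-q x≤k k≤n)

  beforeLast-unguarded : ∀ k q → k ≤ n → onlyIf (k <ᵇ n) (beforeLast (suc k) q) ≈ beforeLast (suc k) q
  beforeLast-unguarded k q k≤n with k <ᵇ n in k<ᵇn
  ... | true  = 𝕊.refl
  ... | false = 𝕊.sym (sumS1-zero (n ∸ 1) _ (λ m _ m≤n-1 →
    onlyIf-≡ _ (≥⇒<ᵇ-false {k} (ℕₚ.≤-trans m≤n-1 (ℕₚ.≤-trans (ℕₚ.m∸n≤m n 1) (<ᵇ-false⇒≥ {k} k<ᵇn))))))

  explicit-solves : Solves n explicit
  explicit-solves k p V@(_ , _ , k≤n) a b c d =
    ≡.trans (≡.cong (_+ ρ) (beforeLast-unfold k p V a b c d))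
    (≡.trans (swap ψ σᴬ ρ)
    (≡.trans (≡.cong (σᴬ +_) (afterLast-unfold k p V a b c d))
    (≡.trans (swap′ σᴬ ι σᴿ)
    (≡.sym (≡.cong (ι +_) (≡.trans (sumSuffixes-cong p regroup a b c d) (sumSuffixes-⊕ p FA FR a b c d)))))))
    where
    FA FR : List ℕ → Series
    FA q = arcWeight k q ⊗ beforeLast k q ⊕ beforeLast (suc k) (suc k ∷ q)
    FR = arcFrom n afterLast k
    ψ σᴬ ρ ι σᴿ : ℕ
    ψ  = onlyIf (k <ᵇ n) (lastChild k) a b c d
    σᴬ = sumSuffixes p FA a b c d
    ρ  = afterLast k p a b c d
    ι  = onlyIf (k ≡ᵇ n) oneS a b c d
    σᴿ = sumSuffixes p FR a b c d
    swap : ∀ A B C → (A + B) + C ≡ B + (A + C)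
    swap = solve-∀
    swap′ : ∀ A B C → A + (B + C) ≡ B + (A + C)
    swap′ = solve-∀
    regroup : ∀ q → arcWeight k q ⊗ explicit k q ⊕ onlyIf (k <ᵇ n) (explicit (suc k) (suc k ∷ q)) ≈ FA q ⊕ FR q
    regroup q = 𝕊.trans (𝕊.+-cong (⊗-distribˡ (arcWeight k q) (beforeLast k q) (afterLast k q))
        (𝕊.trans (onlyIf-⊕ (k <ᵇ n) (beforeLast (suc k) (suc k ∷ q)) (afterLast (suc k) (suc k ∷ q)))
                 (𝕊.+-congʳ (beforeLast-unguarded k (suc k ∷ q) k≤n))))
      (⊕-interchange (arcWeight k q ⊗ beforeLast k q) (arcWeight k q ⊗ afterLast k q)
                     (beforeLast (suc k) (suc k ∷ q)) (onlyIf (k <ᵇ n) (afterLast (suc k) (suc k ∷ q))))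

solution-decomposes : ∀ n (Φ : ℕ → ℕ → List ℕ → Series) → (∀ N → Solves N (Φ N)) → 2 ≤ n →
  Φ n 1 [ 1 ] ≈ inv1- (wS ⊕ (n ∸ 1) · xS) ⊗ sumS1 (n ∸ 1) (λ m → Φ m 1 [ 1 ] ⊗ substW (subtreeSubst m) (Φ (n ∸ m) 1 [ 1 ]))
solution-decomposes n Φ solΦ (s≤s (s≤s _)) = begin
  Φ n 1 [ 1 ]
    ≈⟨ solution-unique (solΦ n) explicit-solves 1 [ 1 ] (≡.refl , ℕₚ.≤-refl , s≤s z≤n) ⟩
  beforeLast 1 [ 1 ] ⊕ zeroS
    ≈⟨ 𝕊.trans (𝕊.+-identityʳ _) (sumS1-cong (n ∸ 1) term) ⟩
  sumS1 (n ∸ 1) (λ m → rootTail ⊗ (Φ m 1 [ 1 ] ⊗ subtree m))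
    ≈⟨ 𝕊.sym (⊗-distribˡ-sumS1 (n ∸ 1) _ rootTail) ⟩
  rootTail ⊗ sumS1 (n ∸ 1) (λ m → Φ m 1 [ 1 ] ⊗ subtree m) ∎
  where
  open Decomposition n Φ solΦ
  subtree : ℕ → Series
  subtree m = substW (subtreeSubst m) (Φ (n ∸ m) 1 [ 1 ])
  lastChild≈ : ∀ m → lastChild m ≈ subtree m ⊗ rootTail
  lastChild≈ m = 𝕊.reflexive (≡.cong (λ j → substW (subtreeSubst m) (Φ (n ∸ m) j [ j ]) ⊗ rootTail) (ℕₚ.m+n∸n≡m 1 m))
  term : ∀ m → 1 ≤ m → m ≤ n ∸ 1 → onlyIf (1 ≤ᵇ m) (Φ m 1 [ 1 ] ⊗ lastChild m) ≈ rootTail ⊗ (Φ m 1 [ 1 ] ⊗ subtree m)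
  term m@(suc _) _ _ = 𝕊.trans (⊗-congˡ (Φ m 1 [ 1 ]) (lastChild≈ m))
    (𝕊.trans (𝕊.sym (⊗-assoc (Φ m 1 [ 1 ]) (subtree m) rootTail)) (⊗-comm (Φ m 1 [ 1 ] ⊗ subtree m) rootTail))

geometric-solves : Solves 1 (λ _ _ → inv1- wS)
geometric-solves k             []          (() , _)
geometric-solves (suc zero)    (x ∷ [])    (≡.refl , _) = 𝕊.trans (geometric-unfold 1 0 0 0 w-linear)
  (𝕊.+-congˡ (𝕊.trans (⊗-congʳ (inv1- wS) w-linear) (𝕊.sym (𝕊.trans (𝕊.+-identityʳ _) (𝕊.+-identityʳ _)))))
  where
  w-linear : wS ≈ linear 1 0 0 0
  w-linear a b c d = identity (wS a b c d) (xS a b c d) (yS a b c d) (zS a b c d)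
    where
    identity : ∀ w x y z → w ≡ 1 * w + 0 * x + 0 * y + 0 * z
    identity = solve-∀
geometric-solves zero          (x ∷ [])    (≡.refl , () , _)
geometric-solves (suc (suc k)) (x ∷ [])    (_ , _ , s≤s ())
geometric-solves k             (x ∷ y ∷ r) ((y<x , ch) , x≤k , k≤1) =
  ⊥-elim (ℕₚ.<⇒≱ (ℕₚ.<-≤-trans (ℕₚ.≤-<-trans (chain-bottom≤top (y ∷ r) ch) y<x) x≤k) k≤1)

-- Counting explorations through abstract states

count : ∀ {A : Set} → (A → Bool) → List A → ℕ
count p []       = 0
count p (x ∷ xs) = (if p x then 1 else 0) + count p xs

length-filterᵇ : ∀ {A : Set} (p : A → Bool) xs → length (filterᵇ p xs) ≡ count p xs
length-filterᵇ p []       = ≡.refl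
length-filterᵇ p (x ∷ xs) with p x
... | true  = ≡.cong suc (length-filterᵇ p xs)
... | false = length-filterᵇ p xs

count-cong : ∀ {A : Set} {p q : A → Bool} xs → (∀ x → p x ≡ q x) → count p xs ≡ count q xs
count-cong []       e = ≡.refl
count-cong (x ∷ xs) e = ≡.cong₂ _+_ (≡.cong (λ b → if b then 1 else 0) (e x)) (count-cong xs e)

count-false : ∀ {A : Set} (xs : List A) → count (λ _ → false) xs ≡ 0
count-false []       = ≡.refl
count-false (x ∷ xs) = count-false xs

count-++ : ∀ {A : Set} (p : A → Bool) xs ys → count p (xs ++ ys) ≡ count p xs + count p ys
count-++ p []       ys = ≡.refl
count-++ p (x ∷ xs) ys =
  ≡.trans (≡.cong (_ +_) (count-++ p xs ys)) (≡.sym (ℕₚ.+-assoc (if p x then 1 else 0) (count p xs) (count p ys)))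

count-map : ∀ {A B : Set} (p : B → Bool) (g : A → B) xs → count p (map g xs) ≡ count (p ∘ g) xs
count-map p g []       = ≡.refl
count-map p g (x ∷ xs) = ≡.cong (_ +_) (count-map p g xs)

sumOver : ∀ {A : Set} → List A → (A → ℕ) → ℕ
sumOver []       f = 0
sumOver (x ∷ xs) f = f x + sumOver xs f

sumOver-cong : ∀ {A : Set} xs {f g : A → ℕ} → (∀ x → f x ≡ g x) → sumOver xs f ≡ sumOver xs g
sumOver-cong []       e = ≡.refl
sumOver-cong (x ∷ xs) e = ≡.cong₂ _+_ (e x) (sumOver-cong xs e)

sumOver-++ : ∀ {A : Set} xs ys (f : A → ℕ) → sumOver (xs ++ ys) f ≡ sumOver xs f + sumOver ys f
sumOver-++ []       ys f = ≡.refl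
sumOver-++ (x ∷ xs) ys f = ≡.trans (≡.cong (f x +_) (sumOver-++ xs ys f)) (≡.sym (ℕₚ.+-assoc (f x) _ _))

sumOver-map : ∀ {A B : Set} (g : A → B) xs (f : B → ℕ) → sumOver (map g xs) f ≡ sumOver xs (f ∘ g)
sumOver-map g []       f = ≡.refl
sumOver-map g (x ∷ xs) f = ≡.cong (f (g x) +_) (sumOver-map g xs f)

count-concatMap : ∀ {A B : Set} (p : B → Bool) (f : A → List B) xs → count p (concatMap f xs) ≡ sumOver xs (count p ∘ f)
count-concatMap p f []       = ≡.refl
count-concatMap p f (x ∷ xs) = ≡.trans (count-++ p (f x) (concatMap f xs)) (≡.cong (count p (f x) +_) (count-concatMap p f xs))

sumOver-cartesianProduct : ∀ {A B : Set} (xs : List A) (ys : List B) f →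
  sumOver (cartesianProduct xs ys) f ≡ sumOver xs (λ u → sumOver ys (λ v → f (u , v)))
sumOver-cartesianProduct []       ys f = ≡.refl
sumOver-cartesianProduct (x ∷ xs) ys f = ≡.trans (sumOver-++ (map (x ,_) ys) _ f)
  (≡.cong₂ _+_ (sumOver-map (x ,_) ys f) (sumOver-cartesianProduct xs ys f))

oneTo-suc : ∀ k → oneTo (suc k) ≡ oneTo k ++ [ suc k ]
oneTo-suc k = ≡.sym (Listₚ.applyUpTo-∷ʳ suc k)

length-oneTo : ∀ k → length (oneTo k) ≡ k
length-oneTo k = Listₚ.length-applyUpTo suc k

∈ᵇ-++ : ∀ v xs ys → (v ∈ᵇ (xs ++ ys)) ≡ ((v ∈ᵇ xs) ∨ (v ∈ᵇ ys))
∈ᵇ-++ v []       ys = ≡.refl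
∈ᵇ-++ v (x ∷ xs) ys with v ≡ᵇ x
... | true  = ≡.refl
... | false = ∈ᵇ-++ v xs ys

∈ᵇ-oneTo-suc : ∀ v k → (v ∈ᵇ oneTo (suc k)) ≡ ((v ∈ᵇ oneTo k) ∨ (v ≡ᵇ suc k))
∈ᵇ-oneTo-suc v k = ≡.trans (≡.cong (v ∈ᵇ_) (oneTo-suc k))
  (≡.trans (∈ᵇ-++ v (oneTo k) [ suc k ]) (≡.cong ((v ∈ᵇ oneTo k) ∨_) (Boolₚ.∨-identityʳ (v ≡ᵇ suc k))))

∈ᵇ-oneTo⇒ : ∀ k v → (v ∈ᵇ oneTo k) ≡ true → 1 ≤ v × v ≤ k
∈ᵇ-oneTo⇒ zero    v ()
∈ᵇ-oneTo⇒ (suc k) v e with v ∈ᵇ oneTo k in e₁ | v ≡ᵇ suc k in e₂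
... | true  | _    = let 1≤v , v≤k = ∈ᵇ-oneTo⇒ k v e₁ in 1≤v , ℕₚ.m≤n⇒m≤1+n v≤k
... | false | true = ≡.subst (1 ≤_) (≡.sym (≡ᵇ⇒≡ e₂)) (s≤s z≤n) , ℕₚ.≤-reflexive (≡ᵇ⇒≡ e₂)
... | false | false with () ← ≡.trans (≡.sym (≡.trans (∈ᵇ-oneTo-suc v k) (≡.cong₂ _∨_ e₁ e₂))) e

∈ᵇ-oneTo : ∀ k v → 1 ≤ v → v ≤ k → (v ∈ᵇ oneTo k) ≡ true
∈ᵇ-oneTo zero    (suc v) _ ()
∈ᵇ-oneTo (suc k) v 1≤v v≤1+k with ℕₚ.m≤n⇒m<n∨m≡n v≤1+k
... | inj₁ v<1+k  = ≡.trans (∈ᵇ-oneTo-suc v k) (≡.cong (_∨ (v ≡ᵇ suc k)) (∈ᵇ-oneTo k v 1≤v (ℕₚ.≤-pred v<1+k)))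
... | inj₂ ≡.refl = ≡.trans (∈ᵇ-oneTo-suc v k) (≡.trans (≡.cong ((v ∈ᵇ oneTo k) ∨_) (≡ᵇ-refl k)) (Boolₚ.∨-zeroʳ _))

chain-∈ᵇ-bounds : ∀ {c} p x → Chain c p → (x ∈ᵇ p) ≡ true → c ≤ x × x ≤ top p
chain-∈ᵇ-bounds []          x ()
chain-∈ᵇ-bounds (y ∷ [])    x ≡.refl e with x ≡ᵇ y in x≡ᵇy
... | true = ℕₚ.≤-reflexive (≡.sym (≡ᵇ⇒≡ x≡ᵇy)) , ℕₚ.≤-reflexive (≡ᵇ⇒≡ x≡ᵇy)
chain-∈ᵇ-bounds {c} (y ∷ z ∷ r) x (z<y , ch) e = at-or-below (x ≡ᵇ y) ≡.refl e (chain-∈ᵇ-bounds (z ∷ r) x ch)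
  where
  at-or-below : ∀ b → (x ≡ᵇ y) ≡ b → (b ∨ (x ∈ᵇ (z ∷ r))) ≡ true →
    ((x ∈ᵇ (z ∷ r)) ≡ true → c ≤ x × x ≤ z) → c ≤ x × x ≤ y
  at-or-below true  x≡ᵇy _ _ = ℕₚ.≤-trans (chain-bottom≤top (z ∷ r) ch) (ℕₚ.≤-trans (ℕₚ.<⇒≤ z<y)
    (ℕₚ.≤-reflexive (≡.sym (≡ᵇ⇒≡ x≡ᵇy)))) , ℕₚ.≤-reflexive (≡ᵇ⇒≡ x≡ᵇy)
  at-or-below false _     e′ below = map₂ (λ x≤z → ℕₚ.≤-trans x≤z (ℕₚ.<⇒≤ z<y)) (below e′)

chain-∉ᵇ-above : ∀ {c} p x → Chain c p → top p < x → (x ∈ᵇ p) ≡ false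
chain-∉ᵇ-above p x ch top<x with x ∈ᵇ p in e
... | false = ≡.refl
... | true  = ⊥-elim (ℕₚ.<⇒≱ top<x (proj₂ (chain-∈ᵇ-bounds p x ch e)))

top-popTo : ∀ {c} u p → Chain c p → (u ∈ᵇ p) ≡ true → top (popTo u p) ≡ u
top-popTo u []          ()
top-popTo u (x ∷ p)     ch e with u ≡ᵇ x in u≡ᵇx
... | true = ≡.sym (≡ᵇ⇒≡ u≡ᵇx)
top-popTo u (x ∷ y ∷ p) (_ , ch) e | false = top-popTo u (y ∷ p) ch e

chain-popTo : ∀ {c} u p → Chain c p → (u ∈ᵇ p) ≡ true → Chain c (popTo u p)
chain-popTo u []          ()
chain-popTo u (x ∷ p)     ch e with u ≡ᵇ x
... | true = ch
chain-popTo u (x ∷ y ∷ p) (_ , ch) e | false = chain-popTo u (y ∷ p) ch e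

popTo-⊆ : ∀ u p x → (x ∈ᵇ popTo u p) ≡ true → (x ∈ᵇ p) ≡ true
popTo-⊆ u []      x e = e
popTo-⊆ u (y ∷ p) x e with u ≡ᵇ y
... | true  = e
... | false with x ≡ᵇ y
...   | true  = ≡.refl
...   | false = popTo-⊆ u p x e

popTo-≤ : ∀ {c} u p → Chain c p → (u ∈ᵇ p) ≡ true → ∀ x → (x ∈ᵇ popTo u p) ≡ true → x ≤ u
popTo-≤ u p ch e x x∈ =
  ≡.subst (x ≤_) (top-popTo u p ch e) (proj₂ (chain-∈ᵇ-bounds (popTo u p) x (chain-popTo u p ch e) x∈))

ParentsBelow : ℕ → List (ℕ × ℕ) → Set
ParentsBelow k t = ∀ v c → parentOf t v ≡ just c → c < v × 1 ≤ c × v ≤ k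

ancestors-< : ∀ {k t} → ParentsBelow k t → ∀ f v x → (x ∈ᵇ ancestors f t v) ≡ true → x < v
ancestors-< {t = t} pb (suc f) v x e with parentOf t v in parent
... | just c = via (x ≡ᵇ c) ≡.refl e
  where
  c<v : c < v
  c<v = proj₁ (pb v c parent)
  via : ∀ b → (x ≡ᵇ c) ≡ b → (b ∨ (x ∈ᵇ ancestors f t c)) ≡ true → x < v
  via true  x≡ᵇc _  = ≡.subst (_< v) (≡.sym (≡ᵇ⇒≡ x≡ᵇc)) c<v
  via false _     e′ = ℕₚ.<-trans (ancestors-< pb f c x e′) c<v

ancestors-∌ : ∀ {k t} → ParentsBelow k t → ∀ f v x → v ≤ x → (x ∈ᵇ ancestors f t v) ≡ false
ancestors-∌ {t = t} pb f v x v≤x with x ∈ᵇ ancestors f t v in e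
... | false = ≡.refl
... | true  = ⊥-elim (ℕₚ.<⇒≱ (ancestors-< pb f v x e) v≤x)

ancestors-fuel : ∀ {k t} → ParentsBelow k t → ∀ f f′ v → v ≤ f → v ≤ f′ → ancestors f t v ≡ ancestors f′ t v
ancestors-fuel pb zero    zero     v    _   _    = ≡.refl
ancestors-fuel {t = t} pb zero    (suc f′) zero _   _    with parentOf t zero in parent
... | nothing = ≡.refl
... | just c  = ⊥-elim (ℕₚ.n≮0 (proj₁ (pb zero c parent)))
ancestors-fuel {t = t} pb (suc f) zero     zero _   _    with parentOf t zero in parent
... | nothing = ≡.refl
... | just c  = ⊥-elim (ℕₚ.n≮0 (proj₁ (pb zero c parent)))
ancestors-fuel {t = t} pb (suc f) (suc f′) v    v≤f v≤f′ with parentOf t v in parent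
... | nothing = ≡.refl
... | just c  = ≡.cong (c ∷_) (ancestors-fuel pb f f′ c (ℕₚ.≤-pred (ℕₚ.<-≤-trans c<v v≤f)) (ℕₚ.≤-pred (ℕₚ.<-≤-trans c<v v≤f′)))
  where
  c<v : c < v
  c<v = proj₁ (pb v c parent)

parentOf-old : ∀ k u t w → w ≤ k → parentOf ((suc k , u) ∷ t) w ≡ parentOf t w
parentOf-old k u t w w≤k
  rewrite ≢⇒≡ᵇ-false {w} {suc k} (λ w≡1+k → ℕₚ.<⇒≱ (s≤s w≤k) (ℕₚ.≤-reflexive (≡.sym w≡1+k))) = ≡.refl

ancestors-old : ∀ {k t} u → ParentsBelow k t → ∀ g w → w ≤ k → ancestors g ((suc k , u) ∷ t) w ≡ ancestors g t w
ancestors-old u pb zero    w w≤k = ≡.refl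
ancestors-old {k} {t} u pb (suc g) w w≤k rewrite parentOf-old k u t w w≤k with parentOf t w in parent
... | nothing = ≡.refl
... | just c  = ≡.cong (c ∷_) (ancestors-old u pb g c (ℕₚ.≤-trans (ℕₚ.<⇒≤ (proj₁ (pb w c parent))) w≤k))

ancestors-new : ∀ {k t} u → ParentsBelow k t → u ≤ k → ancestors (suc k) ((suc k , u) ∷ t) (suc k) ≡ u ∷ ancestors k t u
ancestors-new {k} u pb u≤k rewrite ≡ᵇ-refl k = ≡.cong (u ∷_) (ancestors-old u pb k u u≤k)

record Invariant (k : ℕ) (p : List ℕ) (t : List (ℕ × ℕ)) : Set where
  constructor invariant
  field
    parents   : ParentsBelow k t
    path      : Chain 1 p
    top≤k     : top p ≤ k
    ancestral : ∀ x v → (x ∈ᵇ p) ≡ true → (v ∈ᵇ oneTo k) ≡ true → (x ∈ᵇ ancestors k t v) ≡ (x <ᵇ v)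

invariant-popTo : ∀ {k p t} u → Invariant k p t → (u ∈ᵇ p) ≡ true → Invariant k (popTo u p) t
invariant-popTo {k} {p} u (invariant pb ch p≤k anc) u∈p = invariant pb (chain-popTo u p ch u∈p)
  (≡.subst (_≤ k) (≡.sym (top-popTo u p ch u∈p)) (ℕₚ.≤-trans (proj₂ (chain-∈ᵇ-bounds p u ch u∈p)) p≤k))
  (λ x v x∈ v∈ → anc x v (popTo-⊆ u p x x∈) v∈)

≤⇒≡ᵇ∨<ᵇ : ∀ x u → x ≤ u → ((x ≡ᵇ u) ∨ (x <ᵇ u)) ≡ true
≤⇒≡ᵇ∨<ᵇ x u x≤u with ℕₚ.m≤n⇒m<n∨m≡n x≤u
... | inj₁ x<u    rewrite <⇒<ᵇ-true x<u = Boolₚ.∨-zeroʳ (x ≡ᵇ u)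
... | inj₂ ≡.refl rewrite ≡ᵇ-refl x    = ≡.refl

invariant-tree : ∀ {k p t} u → Invariant k p t → (u ∈ᵇ p) ≡ true →
  Invariant (suc k) (suc k ∷ popTo u p) ((suc k , u) ∷ t)
invariant-tree {k} {p} {t} u (invariant pb ch p≤k anc) u∈p = invariant pb′ ch′ ℕₚ.≤-refl anc′
  where
  q  = popTo u p
  t′ : List (ℕ × ℕ)
  t′ = (suc k , u) ∷ t
  u≤k : u ≤ k
  u≤k = ℕₚ.≤-trans (proj₂ (chain-∈ᵇ-bounds p u ch u∈p)) p≤k
  1≤u : 1 ≤ u
  1≤u = proj₁ (chain-∈ᵇ-bounds p u ch u∈p)
  pb′ : ParentsBelow (suc k) t′
  pb′ w c parent with w ≡ᵇ suc k in w≡ᵇ1+k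
  pb′ w c ≡.refl | true  = ≡.subst (u <_) (≡.sym (≡ᵇ⇒≡ w≡ᵇ1+k)) (s≤s u≤k) , 1≤u , ℕₚ.≤-reflexive (≡ᵇ⇒≡ w≡ᵇ1+k)
  pb′ w c parent | false = let c<w , 1≤c , w≤k = pb w c parent in c<w , 1≤c , ℕₚ.m≤n⇒m≤1+n w≤k
  ch′ : Chain 1 (suc k ∷ q)
  ch′ = push q (chain-popTo u p ch u∈p) (top-popTo u p ch u∈p)
    where
    push : ∀ q → Chain 1 q → top q ≡ u → Chain 1 (suc k ∷ q)
    push []      ()
    push (y ∷ r) ch-q ≡.refl = s≤s u≤k , ch-q
  anc′ : ∀ x v → (x ∈ᵇ (suc k ∷ q)) ≡ true → (v ∈ᵇ oneTo (suc k)) ≡ true →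
    (x ∈ᵇ ancestors (suc k) t′ v) ≡ (x <ᵇ v)
  anc′ x v x∈ v∈ with ∈ᵇ-oneTo⇒ (suc k) v v∈ | x ≡ᵇ suc k in x≡ᵇ1+k
  ... | 1≤v , v≤1+k | true rewrite ≡ᵇ⇒≡ {x} {suc k} x≡ᵇ1+k =
    ≡.trans (ancestors-∌ pb′ (suc k) v (suc k) v≤1+k) (≡.sym (≥⇒<ᵇ-false v≤1+k))
  ... | 1≤v , v≤1+k | false with ℕₚ.m≤n⇒m<n∨m≡n v≤1+k
  ...   | inj₂ ≡.refl = ≡.trans (≡.cong (x ∈ᵇ_) (ancestors-new u pb u≤k))
          (≡.trans (≡.cong ((x ≡ᵇ u) ∨_) (anc x u (popTo-⊆ u p x x∈) (∈ᵇ-oneTo k u 1≤u u≤k)))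
          (≡.trans (≤⇒≡ᵇ∨<ᵇ x u x≤u) (≡.sym (<⇒<ᵇ-true (s≤s (ℕₚ.≤-trans x≤u u≤k))))))
    where
    x≤u : x ≤ u
    x≤u = popTo-≤ u p ch u∈p x x∈
  ...   | inj₁ v<1+k = ≡.trans (≡.cong (x ∈ᵇ_) (≡.trans (ancestors-old u pb (suc k) v (ℕₚ.≤-pred v<1+k))
            (ancestors-fuel pb (suc k) k v (ℕₚ.m≤n⇒m≤1+n (ℕₚ.≤-pred v<1+k)) (ℕₚ.≤-pred v<1+k))))
          (anc x v (popTo-⊆ u p x x∈) (∈ᵇ-oneTo k v 1≤v (ℕₚ.≤-pred v<1+k)))

-- 'step' on the state (1, …, k discovered, active path p). By 'Invariant', a discovered v is a
-- proper descendant of the current vertex u iff u < v.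
abstractStep : ℕ → List ℕ → Arc → Maybe (Kind × List ℕ)
abstractStep k p (u , v) =
  if not (u ∈ᵇ p) then nothing else
  (if v ≡ᵇ u then just (loop , q)
   else if not (v ∈ᵇ oneTo k) then (if v ≡ᵇ suc k then just (tree , q) else nothing)
   else if v ∈ᵇ q then just (back , q)
   else if u <ᵇ v then just (forward , q)
   else just (cross , q))
  where
  q : List ℕ
  q = popTo u p

nextCount : ℕ → Kind → ℕ
nextCount k tree = suc k
nextCount k _    = k

nextPath : ℕ → Kind → List ℕ → List ℕ
nextPath k tree q = suc k ∷ q
nextPath k _    q = q

Represents : State → ℕ → List ℕ → Set
Represents (st d act t) k p = d ≡ oneTo k × act ≡ p × Invariant k p t

StepAgrees : ℕ → Maybe (State × Kind) → Maybe (Kind × List ℕ) → Set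
StepAgrees k nothing            nothing          = ⊤
StepAgrees k (just (s′ , kind)) (just (kind′ , q)) = kind ≡ kind′ × Represents s′ (nextCount k kind) (nextPath k kind q)
StepAgrees k _                  _                = ⊥

step-agrees : ∀ s k p → Represents s k p → ∀ a → StepAgrees k (step s a) (abstractStep k p a)
step-agrees (st _ _ t) k p (≡.refl , ≡.refl , I) (u , v) rewrite length-oneTo k with u ∈ᵇ p in u∈p
... | false = tt
... | true with v ≡ᵇ u
...   | true = ≡.refl , ≡.refl , ≡.refl , invariant-popTo u I u∈p
...   | false with v ∈ᵇ oneTo k in v∈
...     | false with v ≡ᵇ suc k in v≡ᵇ1+k
...       | false = tt
...       | true rewrite ≡ᵇ⇒≡ {v} {suc k} v≡ᵇ1+k = ≡.refl , ≡.sym (oneTo-suc k) , ≡.refl , invariant-tree u I u∈p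
step-agrees (st _ _ t) k p (≡.refl , ≡.refl , I) (u , v) | true | false | true with v ∈ᵇ popTo u p
...       | true = ≡.refl , ≡.refl , ≡.refl , invariant-popTo u I u∈p
...       | false rewrite Invariant.ancestral I u v u∈p v∈ with u <ᵇ v
...         | true  = ≡.refl , ≡.refl , ≡.refl , invariant-popTo u I u∈p
...         | false = ≡.refl , ≡.refl , ≡.refl , invariant-popTo u I u∈p

abstractRun : ℕ → List ℕ → Stats → List Arc → Maybe (ℕ × List ℕ × Stats)
abstractRun k p acc []       = just (k , p , acc)
abstractRun k p acc (a ∷ as) with abstractStep k p a
... | nothing          = nothing
... | just (kind , q)  = abstractRun (nextCount k kind) (nextPath k kind q) (bump kind acc) as

RunAgrees : Maybe (State × Stats) → Maybe (ℕ × List ℕ × Stats) → Set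
RunAgrees nothing        nothing              = ⊤
RunAgrees (just (s , x)) (just (k , p , y))   = Represents s k p × x ≡ y
RunAgrees _              _                    = ⊥

run-agrees : ∀ s k p acc S → Represents s k p → RunAgrees (run s acc S) (abstractRun k p acc S)
run-agrees s k p acc []       R = R , ≡.refl
run-agrees s k p acc (a ∷ as) R with step s a | abstractStep k p a | step-agrees s k p R a
... | nothing         | nothing         | _         = tt
... | just (s′ , kind) | just (.kind , q) | ≡.refl , R′ =
  run-agrees s′ (nextCount k kind) (nextPath k kind q) (bump kind acc) as R′

represents-init : Represents initState 1 [ 1 ]
represents-init = ≡.refl , ≡.refl , invariant (λ v c ()) ≡.refl ℕₚ.≤-refl ancestral
  where
  ancestral : ∀ x v → (x ∈ᵇ [ 1 ]) ≡ true → (v ∈ᵇ oneTo 1) ≡ true → (x ∈ᵇ ancestors 1 [] v) ≡ (x <ᵇ v)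
  ancestral x v x∈ v∈ with x ≡ᵇ 1 in x≡ᵇ1 | v ≡ᵇ 1 in v≡ᵇ1
  ... | true | true rewrite ≡ᵇ⇒≡ {x} {1} x≡ᵇ1 | ≡ᵇ⇒≡ {v} {1} v≡ᵇ1 = ≡.refl

accepts : ℕ → ℕ → ℕ → ℕ → ℕ → Maybe (ℕ × List ℕ × Stats) → Bool
accepts N a b c d nothing                             = false
accepts N a b c d (just (k , p , stats l f bb cc)) = (k ≡ᵇ N) ∧ (l ≡ᵇ a) ∧ (f ≡ᵇ b) ∧ (bb ≡ᵇ c) ∧ (cc ≡ᵇ d)

validWith≡accepts : ∀ N a b c d S → validWith N a b c d S ≡ accepts N a b c d (abstractRun 1 [ 1 ] (stats 0 0 0 0) S)
validWith≡accepts N a b c d S with run initState (stats 0 0 0 0) S | abstractRun 1 [ 1 ] (stats 0 0 0 0) S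
  | run-agrees initState 1 [ 1 ] (stats 0 0 0 0) S represents-init
... | nothing                             | nothing              | _ = ≡.refl
... | just (st _ _ _ , stats l f bb cc) | just (k , p , ._) | (≡.refl , ≡.refl , _) , ≡.refl
  rewrite length-oneTo k = ≡.refl

Count : ℕ → ℕ → List ℕ → Stats → ℕ → ℕ → ℕ → ℕ → ℕ → ℕ
Count N k p acc L a b c d = count (λ S → accepts N a b c d (abstractRun k p acc S)) (seqs N L)

countAfter : ℕ → ℕ → Stats → ℕ → ℕ → ℕ → ℕ → ℕ → Maybe (Kind × List ℕ) → ℕ
countAfter N k acc L a b c d nothing          = 0
countAfter N k acc L a b c d (just (κ , q)) = Count N (nextCount k κ) (nextPath k κ q) (bump κ acc) L a b c d

Count-suc : ∀ N k p acc L a b c d →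
  Count N k p acc (suc L) a b c d ≡ sumOver (arcs N) (countAfter N k acc L a b c d ∘ abstractStep k p)
Count-suc N k p acc L a b c d = ≡.trans (count-concatMap _ (λ arc → map (arc ∷_) (seqs N L)) (arcs N))
  (sumOver-cong (arcs N) (λ arc → ≡.trans (count-map _ (arc ∷_) (seqs N L)) (first-arc arc)))
  where
  first-arc : ∀ arc → count (λ S → accepts N a b c d (abstractRun k p acc (arc ∷ S))) (seqs N L)
                    ≡ countAfter N k acc L a b c d (abstractStep k p arc)
  first-arc arc with abstractStep k p arc
  ... | nothing      = count-false (seqs N L)
  ... | just (κ , q) = ≡.refl
bump-comm : ∀ κ κ′ s → bump κ (bump κ′ s) ≡ bump κ′ (bump κ s)
bump-comm loop    loop    (stats _ _ _ _) = ≡.refl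
bump-comm loop    tree    (stats _ _ _ _) = ≡.refl
bump-comm loop    back    (stats _ _ _ _) = ≡.refl
bump-comm loop    forward (stats _ _ _ _) = ≡.refl
bump-comm loop    cross   (stats _ _ _ _) = ≡.refl
bump-comm tree    loop    (stats _ _ _ _) = ≡.refl
bump-comm tree    tree    (stats _ _ _ _) = ≡.refl
bump-comm tree    back    (stats _ _ _ _) = ≡.refl
bump-comm tree    forward (stats _ _ _ _) = ≡.refl
bump-comm tree    cross   (stats _ _ _ _) = ≡.refl
bump-comm back    loop    (stats _ _ _ _) = ≡.refl
bump-comm back    tree    (stats _ _ _ _) = ≡.refl
bump-comm back    back    (stats _ _ _ _) = ≡.refl
bump-comm back    forward (stats _ _ _ _) = ≡.refl
bump-comm back    cross   (stats _ _ _ _) = ≡.refl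
bump-comm forward loop    (stats _ _ _ _) = ≡.refl
bump-comm forward tree    (stats _ _ _ _) = ≡.refl
bump-comm forward back    (stats _ _ _ _) = ≡.refl
bump-comm forward forward (stats _ _ _ _) = ≡.refl
bump-comm forward cross   (stats _ _ _ _) = ≡.refl
bump-comm cross   loop    (stats _ _ _ _) = ≡.refl
bump-comm cross   tree    (stats _ _ _ _) = ≡.refl
bump-comm cross   back    (stats _ _ _ _) = ≡.refl
bump-comm cross   forward (stats _ _ _ _) = ≡.refl
bump-comm cross   cross   (stats _ _ _ _) = ≡.refl

mapStats : (Stats → Stats) → Maybe (ℕ × List ℕ × Stats) → Maybe (ℕ × List ℕ × Stats)
mapStats g nothing              = nothing
mapStats g (just (k , p , s)) = just (k , p , g s)

abstractRun-bump : ∀ κ k p acc S → abstractRun k p (bump κ acc) S ≡ mapStats (bump κ) (abstractRun k p acc S)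
abstractRun-bump κ k p acc []       = ≡.refl
abstractRun-bump κ k p acc (a ∷ as) with abstractStep k p a
... | nothing       = ≡.refl
... | just (κ′ , q) rewrite bump-comm κ′ κ acc = abstractRun-bump κ (nextCount k κ′) (nextPath k κ′ q) (bump κ′ acc) as

module _ (N k : ℕ) (p : List ℕ) (acc : Stats) (L : ℕ) where

  Count-bump : ∀ κ {a b c d a′ b′ c′ d′} → (∀ r → accepts N a b c d (mapStats (bump κ) r) ≡ accepts N a′ b′ c′ d′ r) →
    Count N k p (bump κ acc) L a b c d ≡ Count N k p acc L a′ b′ c′ d′
  Count-bump κ shifted = count-cong (seqs N L) (λ S →
    ≡.trans (≡.cong (accepts N _ _ _ _) (abstractRun-bump κ k p acc S)) (shifted (abstractRun k p acc S)))

  Count-bump-none : ∀ κ {a b c d} → (∀ r → accepts N a b c d (mapStats (bump κ) r) ≡ false) →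
    Count N k p (bump κ acc) L a b c d ≡ 0
  Count-bump-none κ rejected = ≡.trans (count-cong (seqs N L) (λ S →
    ≡.trans (≡.cong (accepts N _ _ _ _) (abstractRun-bump κ k p acc S)) (rejected (abstractRun k p acc S))))
    (count-false (seqs N L))

  private
    counts : Series
    counts a b c d = Count N k p acc L a b c d

  Count-loop : ∀ a b c d → Count N k p (bump loop acc) L a b c d ≡ shiftʷ counts a b c d
  Count-loop zero    b c d = Count-bump-none loop λ where
    nothing                             → ≡.refl
    (just (k′ , _ , stats _ _ _ _)) → Boolₚ.∧-zeroʳ (k′ ≡ᵇ N)
  Count-loop (suc a) b c d = Count-bump loop λ where
    nothing                       → ≡.refl
    (just (_ , _ , stats _ _ _ _)) → ≡.refl

  Count-forward : ∀ a b c d → Count N k p (bump forward acc) L a b c d ≡ shiftˣ counts a b c d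
  Count-forward a zero    c d = Count-bump-none forward λ where
    nothing                             → ≡.refl
    (just (k′ , _ , stats l _ _ _)) → ≡.trans (≡.cong ((k′ ≡ᵇ N) ∧_) (Boolₚ.∧-zeroʳ (l ≡ᵇ a))) (Boolₚ.∧-zeroʳ (k′ ≡ᵇ N))
  Count-forward a (suc b) c d = Count-bump forward λ where
    nothing                       → ≡.refl
    (just (_ , _ , stats _ _ _ _)) → ≡.refl

  Count-back : ∀ a b c d → Count N k p (bump back acc) L a b c d ≡ shiftʸ counts a b c d
  Count-back a b zero    d = Count-bump-none back λ where
    nothing                             → ≡.refl
    (just (k′ , _ , stats l f _ _)) → ≡.trans (≡.cong (λ x → (k′ ≡ᵇ N) ∧ ((l ≡ᵇ a) ∧ x)) (Boolₚ.∧-zeroʳ (f ≡ᵇ b)))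
      (≡.trans (≡.cong ((k′ ≡ᵇ N) ∧_) (Boolₚ.∧-zeroʳ (l ≡ᵇ a))) (Boolₚ.∧-zeroʳ (k′ ≡ᵇ N)))
  Count-back a b (suc c) d = Count-bump back λ where
    nothing                       → ≡.refl
    (just (_ , _ , stats _ _ _ _)) → ≡.refl

  Count-cross : ∀ a b c d → Count N k p (bump cross acc) L a b c d ≡ shiftᶻ counts a b c d
  Count-cross a b c zero    = Count-bump-none cross λ where
    nothing                              → ≡.refl
    (just (k′ , _ , stats l f bb _)) →
      ≡.trans (≡.cong (λ x → (k′ ≡ᵇ N) ∧ ((l ≡ᵇ a) ∧ ((f ≡ᵇ b) ∧ x))) (Boolₚ.∧-zeroʳ (bb ≡ᵇ c)))
      (≡.trans (≡.cong (λ x → (k′ ≡ᵇ N) ∧ ((l ≡ᵇ a) ∧ x)) (Boolₚ.∧-zeroʳ (f ≡ᵇ b)))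
      (≡.trans (≡.cong ((k′ ≡ᵇ N) ∧_) (Boolₚ.∧-zeroʳ (l ≡ᵇ a))) (Boolₚ.∧-zeroʳ (k′ ≡ᵇ N))))
  Count-cross a b c (suc d) = Count-bump cross λ where
    nothing                       → ≡.refl
    (just (_ , _ , stats _ _ _ _)) → ≡.refl

sum₁ : ℕ → (ℕ → ℕ) → ℕ
sum₁ zero    f = 0
sum₁ (suc n) f = sum₁ n f + f (suc n)

sum₁-cong : ∀ n {f g} → (∀ i → 1 ≤ i → i ≤ n → f i ≡ g i) → sum₁ n f ≡ sum₁ n g
sum₁-cong zero    e = ≡.refl
sum₁-cong (suc n) e = ≡.cong₂ _+_ (sum₁-cong n (λ i 1≤i i≤n → e i 1≤i (ℕₚ.m≤n⇒m≤1+n i≤n))) (e (suc n) (s≤s z≤n) ℕₚ.≤-refl)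

sum₁-distrib-+ : ∀ n f g → sum₁ n (λ i → f i + g i) ≡ sum₁ n f + sum₁ n g
sum₁-distrib-+ zero    f g = ≡.refl
sum₁-distrib-+ (suc n) f g = ≡.trans (≡.cong (_+ (f (suc n) + g (suc n))) (sum₁-distrib-+ n f g))
  (CommSemigroupProperties.interchange ℕₚ.+-commutativeSemigroup (sum₁ n f) (sum₁ n g) (f (suc n)) (g (suc n)))

sum₁-const : ∀ n {f} X → (∀ i → 1 ≤ i → i ≤ n → f i ≡ X) → sum₁ n f ≡ n * X
sum₁-const zero    X e = ≡.refl
sum₁-const (suc n) X e = ≡.trans (≡.cong₂ _+_ (sum₁-const n X (λ i 1≤i i≤n → e i 1≤i (ℕₚ.m≤n⇒m≤1+n i≤n)))
  (e (suc n) (s≤s z≤n) ℕₚ.≤-refl)) (ℕₚ.+-comm (n * X) X)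

sum₁-zero : ∀ n {f} → (∀ i → 1 ≤ i → i ≤ n → f i ≡ 0) → sum₁ n f ≡ 0
sum₁-zero n e = ≡.trans (sum₁-const n 0 e) (ℕₚ.*-zeroʳ n)

sum₁-split : ∀ a m f → sum₁ (a + m) f ≡ sum₁ a f + sum₁ m (λ i → f (a + i))
sum₁-split a zero    f = ≡.trans (≡.cong (λ s → sum₁ s f) (ℕₚ.+-identityʳ a)) (≡.sym (ℕₚ.+-identityʳ _))
sum₁-split a (suc m) f = ≡.trans (≡.cong (λ s → sum₁ s f) (ℕₚ.+-suc a m)) (≡.trans (≡.cong (_+ f (suc (a + m))) (sum₁-split a m f))
  (≡.trans (ℕₚ.+-assoc (sum₁ a f) _ _) (≡.cong (λ s → sum₁ a f + (sum₁ m (λ i → f (a + i)) + f s)) (≡.sym (ℕₚ.+-suc a m)))))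

sumOver-oneTo : ∀ n f → sumOver (oneTo n) f ≡ sum₁ n f
sumOver-oneTo zero    f = ≡.refl
sumOver-oneTo (suc n) f = ≡.trans (≡.cong (λ xs → sumOver xs f) (oneTo-suc n))
  (≡.trans (sumOver-++ (oneTo n) [ suc n ] f) (≡.cong₂ _+_ (sumOver-oneTo n f) (ℕₚ.+-identityʳ _)))

indicator : Bool → ℕ
indicator b = if b then 1 else 0

sum₁-≡ᵇ : ∀ M x → 1 ≤ x → x ≤ M → sum₁ M (λ v → indicator (v ≡ᵇ x)) ≡ 1
sum₁-≡ᵇ zero    x 1≤x x≤0 = ⊥-elim (ℕₚ.<⇒≱ 1≤x x≤0)
sum₁-≡ᵇ (suc M) x 1≤x x≤1+M with ℕₚ.m≤n⇒m<n∨m≡n x≤1+M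
... | inj₁ x<1+M  = ≡.trans (≡.cong₂ _+_ (sum₁-≡ᵇ M x 1≤x (ℕₚ.≤-pred x<1+M))
                                         (≡.cong indicator (≢⇒≡ᵇ-false {suc M} (λ e → ℕₚ.<⇒≢ x<1+M (≡.sym e))))) ≡.refl
... | inj₂ ≡.refl = ≡.cong₂ _+_ (sum₁-zero M (λ v _ v≤M → ≡.cong indicator (≢⇒≡ᵇ-false (λ e → ℕₚ.<⇒≢ (s≤s v≤M) e))))
                                (≡.cong indicator (≡ᵇ-refl M))

sum₁-indicator≤ : ∀ M (b : ℕ → Bool) → sum₁ M (indicator ∘ b) ≤ M
sum₁-indicator≤ zero    b = z≤n
sum₁-indicator≤ (suc M) b with b (suc M)
... | true  = ≡.subst (_≤ suc M) (ℕₚ.+-comm 1 _) (s≤s (sum₁-indicator≤ M b))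
... | false = ≡.subst (_≤ suc M) (≡.sym (ℕₚ.+-identityʳ _)) (ℕₚ.m≤n⇒m≤1+n (sum₁-indicator≤ M b))

sum₁-if : ∀ M (b : ℕ → Bool) A B →
  sum₁ M (λ v → if b v then A else B) ≡ sum₁ M (indicator ∘ b) * A + (M ∸ sum₁ M (indicator ∘ b)) * B
sum₁-if zero    b A B = ≡.refl
sum₁-if (suc M) b A B with b (suc M)
... | true  rewrite sum₁-if M b A B | ℕₚ.+-comm (sum₁ M (indicator ∘ b)) 1 = regroup (sum₁ M (indicator ∘ b)) A _
  where
  regroup : ∀ c A X → c * A + X + A ≡ (1 + c) * A + X
  regroup = solve-∀
... | false rewrite sum₁-if M b A B | ℕₚ.+-identityʳ (sum₁ M (indicator ∘ b)) | ℕₚ.+-∸-assoc 1 (sum₁-indicator≤ M b) =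
  regroup (sum₁ M (indicator ∘ b)) A (M ∸ sum₁ M (indicator ∘ b)) B
  where
  regroup : ∀ c A X B → c * A + X * B + B ≡ c * A + (1 + X) * B
  regroup = solve-∀

chain-∉ᵇ-tail : ∀ x r → Chain 1 (x ∷ r) → (x ∈ᵇ r) ≡ false
chain-∉ᵇ-tail x []      _          = ≡.refl
chain-∉ᵇ-tail x (y ∷ r) (y<x , ch) = chain-∉ᵇ-above (y ∷ r) x ch y<x

sum₁-∈ᵇ-chain : ∀ M q → Chain 1 q → top q ≤ M → sum₁ M (λ v → indicator (v ∈ᵇ q)) ≡ length q
sum₁-∈ᵇ-chain M []      ()
sum₁-∈ᵇ-chain M (x ∷ r) ch x≤M = ≡.trans (sum₁-cong M (λ v _ _ → split v)) (≡.trans (sum₁-distrib-+ M _ _)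
  (≡.cong₂ _+_ (sum₁-≡ᵇ M x (chain-bottom≤top (x ∷ r) ch) x≤M) (rest r ch)))
  where
  rest : ∀ r → Chain 1 (x ∷ r) → sum₁ M (λ v → indicator (v ∈ᵇ r)) ≡ length r
  rest []      _          = sum₁-zero M (λ _ _ _ → ≡.refl)
  rest (y ∷ r) (y<x , ch) = sum₁-∈ᵇ-chain M (y ∷ r) ch (ℕₚ.≤-trans (ℕₚ.<⇒≤ y<x) x≤M)
  split : ∀ v → indicator (v ∈ᵇ (x ∷ r)) ≡ indicator (v ≡ᵇ x) + indicator (v ∈ᵇ r)
  split v with v ≡ᵇ x in v≡ᵇx
  ... | true rewrite ≡ᵇ⇒≡ {v} {x} v≡ᵇx | chain-∉ᵇ-tail x r ch = ≡.refl
  ... | false = ≡.refl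

module ArcSum (N k : ℕ) (p : List ℕ) (H : Kind → List ℕ → ℕ) (ch : Chain 1 p) (p≤k : top p ≤ k) (k≤N : k ≤ N) where

  valueOf : Maybe (Kind × List ℕ) → ℕ
  valueOf nothing        = 0
  valueOf (just (κ , q)) = H κ q

  arcTotal : List ℕ → ℕ
  arcTotal q = H loop q + (k ∸ top q) * H forward q + (length q ∸ 1) * H back q
             + (top q ∸ length q) * H cross q + indicator (k <ᵇ N) * H tree q

  weight : ℕ → ℕ → ℕ
  weight u v = valueOf (abstractStep k p (u , v))

  module FromActive (u : ℕ) (u∈p : (u ∈ᵇ p) ≡ true) where
    q : List ℕ
    q = popTo u p

    ch-q : Chain 1 q
    ch-q = chain-popTo u p ch u∈p

    top-q : top q ≡ u
    top-q = top-popTo u p ch u∈p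

    u≤k : u ≤ k
    u≤k = ℕₚ.≤-trans (proj₂ (chain-∈ᵇ-bounds p u ch u∈p)) p≤k

    1≤u : 1 ≤ u
    1≤u = proj₁ (chain-∈ᵇ-bounds p u ch u∈p)

    1+[u∸1] : suc (u ∸ 1) ≡ u
    1+[u∸1] = ℕₚ.m+[n∸m]≡n 1≤u

    weight-loop : weight u u ≡ H loop q
    weight-loop rewrite u∈p | ≡ᵇ-refl u = ≡.refl

    weight-forward : ∀ v → u < v → v ≤ k → weight u v ≡ H forward q
    weight-forward v u<v v≤k rewrite u∈p | ≢⇒≡ᵇ-false {v} {u} (λ e → ℕₚ.<⇒≢ u<v (≡.sym e))
      | ∈ᵇ-oneTo k v (ℕₚ.≤-trans (s≤s z≤n) u<v) v≤k
      | chain-∉ᵇ-above q v ch-q (≡.subst (_< v) (≡.sym top-q) u<v) | <⇒<ᵇ-true u<v = ≡.refl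

    weight-undiscovered : ∀ v → k < v → weight u v ≡ (if v ≡ᵇ suc k then H tree q else 0)
    weight-undiscovered v k<v with v ∈ᵇ oneTo k in v∈
    ... | true  = ⊥-elim (ℕₚ.<⇒≱ k<v (proj₂ (∈ᵇ-oneTo⇒ k v v∈)))
    ... | false rewrite u∈p | ≢⇒≡ᵇ-false {v} {u} (λ e → ℕₚ.<⇒≱ k<v (≡.subst (_≤ k) (≡.sym e) u≤k)) with v ≡ᵇ suc k
    ...   | true  = ≡.refl
    ...   | false = ≡.refl

    weight-below : ∀ v → 1 ≤ v → v < u → weight u v ≡ (if v ∈ᵇ q then H back q else H cross q)
    weight-below v 1≤v v<u rewrite u∈p | ≢⇒≡ᵇ-false {v} {u} (ℕₚ.<⇒≢ v<u)
      | ∈ᵇ-oneTo k v 1≤v (ℕₚ.≤-trans (ℕₚ.<⇒≤ v<u) u≤k) | ≥⇒<ᵇ-false {u} {v} (ℕₚ.<⇒≤ v<u) with v ∈ᵇ q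
    ... | true  = ≡.refl
    ... | false = ≡.refl

    path-below-top : ∀ q → Chain 1 q → top q ≡ u → sum₁ (u ∸ 1) (λ v → indicator (v ∈ᵇ q)) ≡ length q ∸ 1
    path-below-top []      ()
    path-below-top (x ∷ r) ch-xr ≡.refl = ≡.trans
      (sum₁-cong (x ∸ 1) (λ v 1≤v v≤x-1 → ≡.cong (λ b → indicator (b ∨ (v ∈ᵇ r))) (≢⇒≡ᵇ-false (ℕₚ.<⇒≢ (below v v≤x-1)))))
      (rest r ch-xr)
      where
      below : ∀ v → v ≤ x ∸ 1 → v < x
      below v v≤x-1 = ℕₚ.<-≤-trans (s≤s v≤x-1) (ℕₚ.≤-reflexive 1+[u∸1])
      rest : ∀ r → Chain 1 (x ∷ r) → sum₁ (x ∸ 1) (λ v → indicator (v ∈ᵇ r)) ≡ length r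
      rest []      _            = sum₁-zero (x ∸ 1) (λ _ _ _ → ≡.refl)
      rest (y ∷ r) (y<x , ch-r) = sum₁-∈ᵇ-chain (x ∸ 1) (y ∷ r) ch-r (ℕₚ.≤-pred (ℕₚ.<-≤-trans y<x (ℕₚ.≤-reflexive (≡.sym 1+[u∸1]))))

    tree-targets : sum₁ (N ∸ k) (λ i → weight u (k + i)) ≡ indicator (k <ᵇ N) * H tree q
    tree-targets = ≡.trans
      (sum₁-cong (N ∸ k) (λ i 1≤i _ → ≡.trans (weight-undiscovered (k + i) (≡.subst (_≤ k + i) (ℕₚ.+-comm k 1) (ℕₚ.+-monoʳ-≤ k 1≤i)))
                                            (≡.cong (λ b → if b then H tree q else 0) (next k i))))
      (≡.trans (sum₁-if (N ∸ k) (_≡ᵇ 1) (H tree q) 0) (total (N ∸ k) ≡.refl))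
      where
      next : ∀ k i → (k + i ≡ᵇ suc k) ≡ (i ≡ᵇ 1)
      next zero    i = ≡.refl
      next (suc k) i = next k i
      total : ∀ M → N ∸ k ≡ M → sum₁ M (indicator ∘ (_≡ᵇ 1)) * H tree q + (M ∸ sum₁ M (indicator ∘ (_≡ᵇ 1))) * 0
                                ≡ indicator (k <ᵇ N) * H tree q
      total zero    e rewrite ≥⇒<ᵇ-false {k} {N} (ℕₚ.m∸n≡0⇒m≤n e) = ≡.refl
      total (suc M) e rewrite sum₁-≡ᵇ (suc M) 1 ℕₚ.≤-refl (s≤s z≤n)
                            | <⇒<ᵇ-true {k} {N} (ℕₚ.m∸n≢0⇒n<m (λ e′ → ℕₚ.0≢1+n (≡.trans (≡.sym e′) e))) =
        ≡.trans (≡.cong (1 * H tree q +_) (ℕₚ.*-zeroʳ M)) (ℕₚ.+-identityʳ _)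

    1+[length∸1] : ∀ q → Chain 1 q → 1 + (length q ∸ 1) ≡ length q
    1+[length∸1] []      ()
    1+[length∸1] (x ∷ r) _ = ≡.refl

    discovered-targets : sum₁ k (weight u) ≡ sum₁ u (weight u) + (k ∸ u) * H forward q
    discovered-targets = ≡.trans (≡.cong (λ M → sum₁ M (weight u)) (≡.sym (ℕₚ.m+[n∸m]≡n u≤k))) (≡.trans (sum₁-split u (k ∸ u) (weight u))
      (≡.cong (sum₁ u (weight u) +_) (sum₁-const (k ∸ u) (H forward q) (λ i 1≤i i≤k-u → weight-forward (u + i)
        (≡.subst (_≤ u + i) (ℕₚ.+-comm u 1) (ℕₚ.+-monoʳ-≤ u 1≤i))
        (≡.subst (u + i ≤_) (ℕₚ.m+[n∸m]≡n u≤k) (ℕₚ.+-monoʳ-≤ u i≤k-u))))))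

    up-to-u : sum₁ u (weight u) ≡ sum₁ (u ∸ 1) (weight u) + H loop q
    up-to-u = ≡.trans (≡.cong (λ M → sum₁ M (weight u)) (≡.sym 1+[u∸1]))
      (≡.cong (sum₁ (u ∸ 1) (weight u) +_) (≡.trans (≡.cong (weight u) 1+[u∸1]) weight-loop))

    below-u : sum₁ (u ∸ 1) (weight u) ≡ sum₁ (u ∸ 1) (λ v → indicator (v ∈ᵇ q)) * H back q
                                       + ((u ∸ 1) ∸ sum₁ (u ∸ 1) (λ v → indicator (v ∈ᵇ q))) * H cross q
    below-u = ≡.trans (sum₁-cong (u ∸ 1) (λ v 1≤v v≤u-1 → weight-below v 1≤v (ℕₚ.<-≤-trans (s≤s v≤u-1) (ℕₚ.≤-reflexive 1+[u∸1]))))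
      (sum₁-if (u ∸ 1) (_∈ᵇ q) (H back q) (H cross q))

    regroup : ∀ B M → B * H back q + (M ∸ B) * H cross q + H loop q + (k ∸ u) * H forward q + indicator (k <ᵇ N) * H tree q
      ≡ H loop q + (k ∸ u) * H forward q + B * H back q + (M ∸ B) * H cross q + indicator (k <ᵇ N) * H tree q
    regroup B M = rearrange (B * H back q) ((M ∸ B) * H cross q) (H loop q) ((k ∸ u) * H forward q) (indicator (k <ᵇ N) * H tree q)
      where
      rearrange : ∀ A B C D E → A + B + C + D + E ≡ C + D + A + B + E
      rearrange = solve-∀

    -- Targets 1 … u ∸ 1 (back or cross), u (loop), u + 1 … k (forward), k + 1 … N (tree).
    sum-targets : sum₁ N (weight u) ≡ arcTotal q
    sum-targets =
      ≡.trans (≡.cong (λ M → sum₁ M (weight u)) (≡.sym (ℕₚ.m+[n∸m]≡n k≤N)))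
      (≡.trans (sum₁-split k (N ∸ k) (weight u))
      (≡.trans (≡.cong₂ _+_ discovered-targets tree-targets)
      (≡.trans (≡.cong (λ s → s + (k ∸ u) * H forward q + indicator (k <ᵇ N) * H tree q) up-to-u)
      (≡.trans (≡.cong (λ s → s + H loop q + (k ∸ u) * H forward q + indicator (k <ᵇ N) * H tree q) below-u)
      (≡.trans (regroup (sum₁ (u ∸ 1) (λ v → indicator (v ∈ᵇ q))) (u ∸ 1))
      (≡.trans (≡.cong (λ B → H loop q + (k ∸ u) * H forward q + B * H back q + ((u ∸ 1) ∸ B) * H cross q
                             + indicator (k <ᵇ N) * H tree q) (path-below-top q ch-q top-q))
      (≡.cong₂ (λ t C → H loop q + (k ∸ t) * H forward q + (length q ∸ 1) * H back q + C * H cross q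
                        + indicator (k <ᵇ N) * H tree q)
         (≡.sym top-q)
         (≡.trans (ℕₚ.∸-+-assoc u 1 (length q ∸ 1)) (≡.cong₂ _∸_ (≡.sym top-q) (1+[length∸1] q ch-q))))))))))

  sum-arcs : sumOver (arcs N) (valueOf ∘ abstractStep k p) ≡ sum₁ N (λ u → if u ∈ᵇ p then arcTotal (popTo u p) else 0)
  sum-arcs = ≡.trans (sumOver-cartesianProduct (oneTo N) (oneTo N) _) (≡.trans (sumOver-oneTo N _)
    (sum₁-cong N (λ u _ _ → ≡.trans (sumOver-oneTo N (weight u)) (from (u ∈ᵇ p) ≡.refl))))
    where
    from : ∀ {u} b → (u ∈ᵇ p) ≡ b → sum₁ N (weight u) ≡ (if u ∈ᵇ p then arcTotal (popTo u p) else 0)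
    from {u} true  u∈p = ≡.trans (FromActive.sum-targets u u∈p)
      (≡.cong (λ b → if b then arcTotal (popTo u p) else 0) (≡.sym u∈p))
    from {u} false u∉p = ≡.trans (sum₁-zero N (λ v _ _ → inactive v))
      (≡.cong (λ b → if b then arcTotal (popTo u p) else 0) (≡.sym u∉p))
      where
      inactive : ∀ v → weight u v ≡ 0
      inactive v rewrite u∉p = ≡.refl

sum₁-popTo : ∀ M p (F : List ℕ → Series) a b c d → Chain 1 p → top p ≤ M →
  sum₁ M (λ u → if u ∈ᵇ p then F (popTo u p) a b c d else 0) ≡ sumSuffixes p F a b c d
sum₁-popTo M []      F a b c d ()
sum₁-popTo M (x ∷ r) F a b c d ch x≤M = ≡.trans (sum₁-cong M (λ u _ _ → split u))
  (≡.trans (sum₁-distrib-+ M _ _) (≡.cong₂ _+_ at-top (rest r ch)))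
  where
  split : ∀ u → (if u ∈ᵇ (x ∷ r) then F (popTo u (x ∷ r)) a b c d else 0)
              ≡ (if u ≡ᵇ x then F (x ∷ r) a b c d else 0) + (if u ∈ᵇ r then F (popTo u r) a b c d else 0)
  split u with u ≡ᵇ x in u≡ᵇx
  ... | true rewrite ≡ᵇ⇒≡ {u} {x} u≡ᵇx | chain-∉ᵇ-tail x r ch = ≡.sym (ℕₚ.+-identityʳ (F (x ∷ r) a b c d))
  ... | false = ≡.refl
  at-top : sum₁ M (λ u → if u ≡ᵇ x then F (x ∷ r) a b c d else 0) ≡ F (x ∷ r) a b c d
  at-top = ≡.trans (sum₁-if M (_≡ᵇ x) (F (x ∷ r) a b c d) 0)
    (≡.trans (≡.cong₂ _+_ (≡.cong (_* F (x ∷ r) a b c d) (sum₁-≡ᵇ M x (chain-bottom≤top (x ∷ r) ch) x≤M))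
                          (ℕₚ.*-zeroʳ (M ∸ sum₁ M (indicator ∘ (_≡ᵇ x)))))
    (≡.trans (ℕₚ.+-identityʳ _) (ℕₚ.*-identityˡ _)))
  rest : ∀ r → Chain 1 (x ∷ r) → sum₁ M (λ u → if u ∈ᵇ r then F (popTo u r) a b c d else 0) ≡ sumSuffixes r F a b c d
  rest []      _          = sum₁-zero M (λ _ _ _ → ≡.refl)
  rest (y ∷ r) (y<x , ch) = sum₁-popTo M (y ∷ r) F a b c d ch (ℕₚ.≤-trans (ℕₚ.<⇒≤ y<x) x≤M)

countSeries : ℕ → ℕ → List ℕ → Series
countSeries N k p a b c d = Count N k p (stats 0 0 0 0) (N ∸ k + a + b + c + d) a b c d

oneS-positive-degree : ∀ a b c d → deg a b c d ≢ 0 → oneS a b c d ≡ 0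
oneS-positive-degree zero    zero    zero    zero    d≢0 = ⊥-elim (d≢0 ≡.refl)
oneS-positive-degree zero    zero    zero    (suc d) _   = ≡.refl
oneS-positive-degree zero    zero    (suc c) d       _   = ≡.refl
oneS-positive-degree zero    (suc b) c       d       _   = ≡.refl
oneS-positive-degree (suc a) b       c       d       _   = ≡.refl

length-zero : ∀ x a b c d → x + a + b + c + d ≡ 0 → x ≡ 0 × a ≡ 0 × b ≡ 0 × c ≡ 0 × d ≡ 0
length-zero zero zero zero zero zero _ = ≡.refl , ≡.refl , ≡.refl , ≡.refl , ≡.refl

countSeries-finished : ∀ N p → countSeries N N p 0 0 0 0 ≡ unfold N (countSeries N) N p 0 0 0 0
countSeries-finished N p =
  ≡.trans (≡.cong (λ L → Count N N p (stats 0 0 0 0) L 0 0 0 0) (≡.trans (plus-zeros (N ∸ N)) (ℕₚ.n∸n≡0 N)))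
  (≡.trans accept-empty (≡.sym (≡.cong₂ _+_ (≡.cong (λ b → onlyIf b oneS 0 0 0 0) (≡ᵇ-refl N))
    (sumSuffixes-zero p _ (λ q → ≡.cong₂ _+_ (no-arc q) (onlyIf-≡ _ (≥⇒<ᵇ-false {N} ℕₚ.≤-refl) 0 0 0 0))))))
  where
  plus-zeros : ∀ x → x + 0 + 0 + 0 + 0 ≡ x
  plus-zeros = solve-∀
  accept-empty : Count N N p (stats 0 0 0 0) 0 0 0 0 0 ≡ 1
  accept-empty rewrite ≡ᵇ-refl N = ≡.refl
  no-arc : ∀ q → (arcWeight N q ⊗ countSeries N N q) 0 0 0 0 ≡ 0
  no-arc q = ≡.trans (linear⊗≈linearAction 1 (N ∸ top q) (length q ∸ 1) (top q ∸ length q) (countSeries N N q) 0 0 0 0)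
    (linearAction-deg0 1 (N ∸ top q) (length q ∸ 1) (top q ∸ length q) (countSeries N N q) 0 0 0 0 ≡.refl)

module _ (N k : ℕ) (q : List ℕ) (L : ℕ) where

  private
    at-length : ∀ {a b c d} → N ∸ k + a + b + c + d ≡ L → Count N k q (stats 0 0 0 0) L a b c d ≡ countSeries N k q a b c d
    at-length e = ≡.cong (λ L → Count N k q (stats 0 0 0 0) L _ _ _ _) (≡.sym e)

  countSeries-loop : ∀ a b c d → N ∸ k + a + b + c + d ≡ suc L →
    Count N k q (bump loop (stats 0 0 0 0)) L a b c d ≡ shiftʷ (countSeries N k q) a b c d
  countSeries-loop zero    b c d _ = Count-loop N k q _ L 0 b c d
  countSeries-loop (suc a) b c d e = ≡.trans (Count-loop N k q _ L (suc a) b c d)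
    (at-length (ℕₚ.suc-injective (≡.trans (≡.sym (≡.cong (λ x → x + b + c + d) (ℕₚ.+-suc (N ∸ k) a))) e)))

  countSeries-forward : ∀ a b c d → N ∸ k + a + b + c + d ≡ suc L →
    Count N k q (bump forward (stats 0 0 0 0)) L a b c d ≡ shiftˣ (countSeries N k q) a b c d
  countSeries-forward a zero    c d _ = Count-forward N k q _ L a 0 c d
  countSeries-forward a (suc b) c d e = ≡.trans (Count-forward N k q _ L a (suc b) c d)
    (at-length (ℕₚ.suc-injective (≡.trans (≡.sym (≡.cong (λ x → x + c + d) (ℕₚ.+-suc (N ∸ k + a) b))) e)))

  countSeries-back : ∀ a b c d → N ∸ k + a + b + c + d ≡ suc L →
    Count N k q (bump back (stats 0 0 0 0)) L a b c d ≡ shiftʸ (countSeries N k q) a b c d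
  countSeries-back a b zero    d _ = Count-back N k q _ L a b 0 d
  countSeries-back a b (suc c) d e = ≡.trans (Count-back N k q _ L a b (suc c) d)
    (at-length (ℕₚ.suc-injective (≡.trans (≡.sym (≡.cong (_+ d) (ℕₚ.+-suc (N ∸ k + a + b) c))) e)))

  countSeries-cross : ∀ a b c d → N ∸ k + a + b + c + d ≡ suc L →
    Count N k q (bump cross (stats 0 0 0 0)) L a b c d ≡ shiftᶻ (countSeries N k q) a b c d
  countSeries-cross a b c zero    _ = Count-cross N k q _ L a b c 0
  countSeries-cross a b c (suc d) e = ≡.trans (Count-cross N k q _ L a b c (suc d))
    (at-length (ℕₚ.suc-injective (≡.trans (≡.sym (ℕₚ.+-suc (N ∸ k + a + b + c) d)) e)))

countSeries-tree : ∀ N k q L a b c d → N ∸ k + a + b + c + d ≡ suc L →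
  indicator (k <ᵇ N) * Count N (suc k) (suc k ∷ q) (stats 0 0 0 0) L a b c d
    ≡ onlyIf (k <ᵇ N) (countSeries N (suc k) (suc k ∷ q)) a b c d
countSeries-tree N k q L a b c d e with k <ᵇ N in k<ᵇN
... | false = ≡.refl
... | true  = ≡.trans (ℕₚ.+-identityʳ _) (≡.cong (λ L → Count N (suc k) (suc k ∷ q) (stats 0 0 0 0) L a b c d)
  (ℕₚ.suc-injective (≡.sym (≡.trans (≡.cong (λ x → x + a + b + c + d) (≡.sym (∸-suc N k (<ᵇ⇒< k<ᵇN)))) e))))
  where
  ∸-suc : ∀ N k → k < N → N ∸ k ≡ suc (N ∸ suc k)
  ∸-suc (suc N) zero    _         = ≡.refl
  ∸-suc (suc N) (suc k) (s≤s k<N) = ∸-suc N k k<N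

countSeries-solves : ∀ N → Solves N (countSeries N)
countSeries-solves N k p V@(ch , p≤k , k≤N) a b c d = by-length (N ∸ k + a + b + c + d) ≡.refl
  where
  F : List ℕ → Series
  F = arcFrom N (countSeries N) k

  by-length : ∀ L → N ∸ k + a + b + c + d ≡ L → countSeries N k p a b c d ≡ unfold N (countSeries N) k p a b c d
  by-length zero e with length-zero (N ∸ k) a b c d e
  ... | N∸k≡0 , ≡.refl , ≡.refl , ≡.refl , ≡.refl with ℕₚ.≤-antisym k≤N (ℕₚ.m∸n≡0⇒m≤n N∸k≡0)
  ... | ≡.refl = countSeries-finished k p
  by-length (suc L) e =
    ≡.trans (≡.cong (λ L → Count N k p (stats 0 0 0 0) L a b c d) e)
    (≡.trans (Count-suc N k p (stats 0 0 0 0) L a b c d)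
    (≡.trans (sumOver-cong (arcs N) (λ arc → after (abstractStep k p arc)))
    (≡.trans A.sum-arcs
    (≡.trans (sum₁-cong N (λ u _ _ → ≡.cong (λ t → if u ∈ᵇ p then t else 0) (arcTotal≡ (popTo u p))))
    (≡.trans (sum₁-popTo N p F a b c d ch (ℕₚ.≤-trans p≤k k≤N))
    (≡.sym (≡.cong (_+ sumSuffixes p F a b c d) not-finished)))))))
    where
    H : Kind → List ℕ → ℕ
    H κ q = Count N (nextCount k κ) (nextPath k κ q) (bump κ (stats 0 0 0 0)) L a b c d
    module A = ArcSum N k p H ch p≤k k≤N
    after : ∀ m → countAfter N k (stats 0 0 0 0) L a b c d m ≡ A.valueOf m
    after nothing        = ≡.refl
    after (just (κ , q)) = ≡.refl
    not-finished : onlyIf (k ≡ᵇ N) oneS a b c d ≡ 0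
    not-finished with k ≡ᵇ N in k≡ᵇN
    ... | false = ≡.refl
    ... | true  = oneS-positive-degree a b c d (λ deg≡0 → ℕₚ.0≢1+n (≡.trans (≡.sym deg≡0) deg≡1+L))
      where
      deg≡1+L : deg a b c d ≡ suc L
      deg≡1+L = ≡.trans (≡.cong (λ x → x + a + b + c + d)
        (≡.sym (≡.trans (≡.cong (N ∸_) (≡ᵇ⇒≡ {k} {N} k≡ᵇN)) (ℕₚ.n∸n≡0 N)))) e
    arcTotal≡ : ∀ q → A.arcTotal q ≡ F q a b c d
    arcTotal≡ q = ≡.trans
      (≡.cong₂ _+_ (≡.cong₂ _+_ (≡.cong₂ _+_ (≡.cong₂ _+_ (countSeries-loop N k q L a b c d e)
        (≡.cong ((k ∸ top q) *_) (countSeries-forward N k q L a b c d e)))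
        (≡.cong ((length q ∸ 1) *_) (countSeries-back N k q L a b c d e)))
        (≡.cong ((top q ∸ length q) *_) (countSeries-cross N k q L a b c d e)))
        (countSeries-tree N k q L a b c d e))
      (≡.trans (regroup (shiftʷ h a b c d) (shiftˣ h a b c d) (shiftʸ h a b c d) (shiftᶻ h a b c d) (k ∸ top q) (length q ∸ 1)
                        (top q ∸ length q) (onlyIf (k <ᵇ N) (countSeries N (suc k) (suc k ∷ q)) a b c d))
        (≡.cong (_+ onlyIf (k <ᵇ N) (countSeries N (suc k) (suc k ∷ q)) a b c d)
          (≡.sym (linear⊗≈linearAction 1 (k ∸ top q) (length q ∸ 1) (top q ∸ length q) h a b c d))))
      where
      h : Series
      h = countSeries N k q
      regroup : ∀ w x y z X Y Z T → w + X * x + Y * y + Z * z + T ≡ (1 * w + X * x + Y * y + Z * z) + T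
      regroup = solve-∀

G≈countSeries : ∀ N → G N ≈ countSeries N 1 [ 1 ]
G≈countSeries N a b c d =
  ≡.trans (length-filterᵇ (validWith N a b c d) sequences) (count-cong sequences (validWith≡accepts N a b c d))
  where
  sequences : List (List Arc)
  sequences = seqs N (N ∸ 1 + a + b + c + d)

proposition3p1 : (G 1 ≈ₛ inv1- wS)
    × (∀ (n : ℕ) → 2 ≤ n →
        G n ≈ₛ (inv1- (wS ⊕ (n ∸ 1) · xS)
                ⊗ sumS1 (n ∸ 1) (λ m → G m ⊗ substW (wS ⊕ yS ⊕ (m ∸ 1) · zS) (G (n ∸ m)))))
proposition3p1 = n≡1 , n≥2
  where
  n≡1 : G 1 ≈ inv1- wS
  n≡1 = 𝕊.trans (G≈countSeries 1)
    (solution-unique (countSeries-solves 1) geometric-solves 1 [ 1 ] (≡.refl , ℕₚ.≤-refl , ℕₚ.≤-refl))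
  n≥2 : ∀ n → 2 ≤ n → G n ≈ inv1- (wS ⊕ (n ∸ 1) · xS) ⊗ sumS1 (n ∸ 1) (λ m → G m ⊗ substW (subtreeSubst m) (G (n ∸ m)))
  n≥2 n 2≤n = 𝕊.trans (G≈countSeries n) (𝕊.trans (solution-decomposes n countSeries countSeries-solves 2≤n)
    (⊗-congˡ (inv1- (wS ⊕ (n ∸ 1) · xS)) (sumS1-cong (n ∸ 1) (λ m _ _ →
      ⊗-cong (𝕊.sym (G≈countSeries m)) (substW-cong (subtreeSubst m) (𝕊.sym (G≈countSeries (n ∸ m))))))))
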